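{- Let $\mathbf R=(I,O,R)$ be a routing area and $(i,o)\in I\times O$ with $R(i,o)=0$. Then the net obtained from $\mathbf R$ by connecting the input $i$ with the output $o$ reduces to the routing area $\mathbf T=(I\setminus\{i\},O\setminus\{o\},T)$, where for all $x\in I\setminus\{i\}$, $y\in O\setminus\{o\}$, $$T(x,y)=R(x,y)+R(x,o)\,R(i,y).$$
   Context: A multirelation between finite sets $A$ and $B$ is a map $R:A\times B\to\mathbb N$. Nets are differential proof nets built from contraction (binary $?$), weakening (0-ary $?$), cocontraction (binary $!$) and coweakening (0-ary $!$) cells, considered modulo associativity and commutativity of contraction and cocontraction and neutrality of weakening for contraction and of coweakening for cocontraction (so a contraction tree with $k$ leaves is well defined, the case $k=0$ being a weakening and $k=1$ a plain wire; similarly for cocontraction trees). Reduction rules used: (ba) a contraction whose principal port is connected to the principal port of a cocontraction is replaced by two contractions (one on each auxiliary wire of the cocontraction) and two cocontractions (one on each auxiliary wire of the contraction), connected crosswise; (s1) coweakening facing contraction becomes two coweakenings; (s2) cocontraction facing weakening becomes two weakenings; ($\epsilon$) coweakening facing weakening is erased. Routing area: given finite sets $I$ (input labels), $O$ (output labels) and a multirelation $R$ between $I$ and $O$, the routing area $\mathbf R=(I,O,R)$ is the net with $|I|+|O|$ free wires, the inputs labelled by $I$ and the outputs by $O$, where each input $i$ is connected to the principal port of a contraction tree, each output $o$ to the principal port of a cocontraction tree, and for each $(i,o)$ the tree of $i$ is connected to the tree of $o$ by exactly $R(i,o)$ wires (leaves). Connecting input $i$ with output $o$ means joining the free wire of output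 $o$ and the free wire of input $i$ into a single wire, so they are no longer free. -}

module Defs where

open import Data.Nat using (ℕ; zero; suc; _+_; _*_; _≡ᵇ_)
open import Data.Bool using (if_then_else_)
open import Data.Fin using (Fin; punchIn)
open import Data.List using (List; []; _∷_; _++_; map; concat; concatMap; length; allFin)
open import Data.List.Relation.Binary.Permutation.Propositional using (_↭_)
open import Data.List.Relation.Unary.All using (All)
open import Data.List.Relation.Unary.Unique.Propositional using (Unique)
open import Data.Sum using (_⊎_)
open import Data.Product using (Σ; _×_; ∃)
open import Relation.Binary.PropositionalEquality using (_≡_; _≢_)
open import Relation.Binary.Construct.Closure.ReflexiveTransitive using (Star)
open import Function.Definitions using (Injective)

-- Wires are names (natural numbers); every wire name occurs exactly
-- twice in a well-formed net (at its two ends: cell ports or free ports).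
-- A cell lists its principal port first, then its auxiliary ports.

Name : Set
Name = ℕ

data Cell : Set where
  contr   : Name → Name → Name → Cell
  weak    : Name → Cell
  cocontr : Name → Name → Name → Cell
  coweak  : Name → Cell

-- A net with m input free wires and n output free wires,
-- plus a number of closed loops (wires with no ports).
record Net (m n : ℕ) : Set where
  constructor net
  field
    cells : List Cell
    ins   : Fin m → Name
    outs  : Fin n → Name
    loops : ℕ
open Net public

namesC : Cell → List Name
namesC (contr a b c)   = a ∷ b ∷ c ∷ []
namesC (weak a)        = a ∷ []
namesC (cocontr a b c) = a ∷ b ∷ c ∷ []
namesC (coweak a)      = a ∷ []

cnt : Name → List Name → ℕ
cnt x []       = 0
cnt x (y ∷ ys) = (if x ≡ᵇ y then 1 else 0) + cnt x ys

occ : ∀ {m n} → Name → Net m n → ℕ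
occ x N = cnt x (concatMap namesC (cells N)
                 ++ map (ins N) (allFin _) ++ map (outs N) (allFin _))

WF : ∀ {m n} → Net m n → Set
WF N = ∀ x → occ x N ≡ 0 ⊎ occ x N ≡ 2

renC : (Name → Name) → Cell → Cell
renC ρ (contr a b c)   = contr (ρ a) (ρ b) (ρ c)
renC ρ (weak a)        = weak (ρ a)
renC ρ (cocontr a b c) = cocontr (ρ a) (ρ b) (ρ c)
renC ρ (coweak a)      = coweak (ρ a)

rename : ∀ {m n} → (Name → Name) → Net m n → Net m n
rename ρ (net cs ι ω l) = net (map (renC ρ) cs) (λ k → ρ (ι k)) (λ k → ρ (ω k)) l

_↦ₙ_ : Name → Name → Name → Name
(y ↦ₙ x) z = if z ≡ᵇ y then x else z

data _≈₁_ {m n : ℕ} : Net m n → Net m n → Set where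
  perm   : ∀ {cs cs' ι ω l} → cs ↭ cs' → net cs ι ω l ≈₁ net cs' ι ω l
  ren    : ∀ {N} (ρ : Name → Name) → Injective _≡_ _≡_ ρ → N ≈₁ rename ρ N
  commC  : ∀ {x y z cs ι ω l} →
           net (contr x y z ∷ cs) ι ω l ≈₁ net (contr x z y ∷ cs) ι ω l
  commK  : ∀ {x y z cs ι ω l} →
           net (cocontr x y z ∷ cs) ι ω l ≈₁ net (cocontr x z y ∷ cs) ι ω l
  assocC : ∀ {x y z u w cs ι ω l} →
           occ w (net (contr x y w ∷ contr w z u ∷ cs) ι ω l) ≡ 2 →
           net (contr x y w ∷ contr w z u ∷ cs) ι ω l
             ≈₁ net (contr x w u ∷ contr w y z ∷ cs) ι ω l
  assocK : ∀ {x y z u w cs ι ω l} →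
           occ w (net (cocontr x y w ∷ cocontr w z u ∷ cs) ι ω l) ≡ 2 →
           net (cocontr x y w ∷ cocontr w z u ∷ cs) ι ω l
             ≈₁ net (cocontr x w u ∷ cocontr w y z ∷ cs) ι ω l
  neutC  : ∀ {x y w cs ι ω l} →
           occ w (net (contr x y w ∷ weak w ∷ cs) ι ω l) ≡ 2 → x ≢ y →
           net (contr x y w ∷ weak w ∷ cs) ι ω l
             ≈₁ rename (y ↦ₙ x) (net cs ι ω l)
  neutCℓ : ∀ {x w cs ι ω l} →
           occ w (net (contr x x w ∷ weak w ∷ cs) ι ω l) ≡ 2 →
           occ x (net (contr x x w ∷ weak w ∷ cs) ι ω l) ≡ 2 →
           net (contr x x w ∷ weak w ∷ cs) ι ω l ≈₁ net cs ι ω (suc l)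
  neutK  : ∀ {x y w cs ι ω l} →
           occ w (net (cocontr x y w ∷ coweak w ∷ cs) ι ω l) ≡ 2 → x ≢ y →
           net (cocontr x y w ∷ coweak w ∷ cs) ι ω l
             ≈₁ rename (y ↦ₙ x) (net cs ι ω l)
  neutKℓ : ∀ {x w cs ι ω l} →
           occ w (net (cocontr x x w ∷ coweak w ∷ cs) ι ω l) ≡ 2 →
           occ x (net (cocontr x x w ∷ coweak w ∷ cs) ι ω l) ≡ 2 →
           net (cocontr x x w ∷ coweak w ∷ cs) ι ω l ≈₁ net cs ι ω (suc l)

-- Reduction rules (ba), (s1), (s2), (ε); the redex is put at the head
-- of the cell list (any position is reachable by 'perm').

data _↦_ {m n : ℕ} : Net m n → Net m n → Set where
  ba  : ∀ {x y₁ y₂ z₁ z₂ a b c d cs ι ω l} →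
        occ x (net (contr x y₁ y₂ ∷ cocontr x z₁ z₂ ∷ cs) ι ω l) ≡ 2 →
        Unique (a ∷ b ∷ c ∷ d ∷ []) →
        All (λ v → occ v (net (contr x y₁ y₂ ∷ cocontr x z₁ z₂ ∷ cs) ι ω l) ≡ 0)
            (a ∷ b ∷ c ∷ d ∷ []) →
        net (contr x y₁ y₂ ∷ cocontr x z₁ z₂ ∷ cs) ι ω l
          ↦ net (cocontr y₁ a b ∷ cocontr y₂ c d ∷ contr z₁ a c ∷ contr z₂ b d ∷ cs) ι ω l
  s1  : ∀ {x y z cs ι ω l} →
        occ x (net (coweak x ∷ contr x y z ∷ cs) ι ω l) ≡ 2 →
        net (coweak x ∷ contr x y z ∷ cs) ι ω l ↦ net (coweak y ∷ coweak z ∷ cs) ι ω l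
  s2  : ∀ {x y z cs ι ω l} →
        occ x (net (cocontr x y z ∷ weak x ∷ cs) ι ω l) ≡ 2 →
        net (cocontr x y z ∷ weak x ∷ cs) ι ω l ↦ net (weak y ∷ weak z ∷ cs) ι ω l
  eps : ∀ {x cs ι ω l} →
        occ x (net (coweak x ∷ weak x ∷ cs) ι ω l) ≡ 2 →
        net (coweak x ∷ weak x ∷ cs) ι ω l ↦ net cs ι ω l

data Step {m n : ℕ} (N N' : Net m n) : Set where
  ≈→  : N ≈₁ N' → Step N N'
  ≈←  : N' ≈₁ N → Step N N'
  red : N ↦ N' → Step N N'

_⇒*_ : ∀ {m n} → Net m n → Net m n → Set
_⇒*_ = Star Step

-- Contraction / cocontraction trees: root wire, list of leaf wires, cells.
-- 'leaf' is the tree with one leaf (a plain wire), 'wk'/'cowk' the tree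
-- with no leaf.

data CTree : Name → List Name → List Cell → Set where
  leaf : ∀ r → CTree r (r ∷ []) []
  wk   : ∀ r → CTree r [] (weak r ∷ [])
  node : ∀ {r a b la lb ca cb} → CTree a la ca → CTree b lb cb →
         CTree r (la ++ lb) (contr r a b ∷ ca ++ cb)

data KTree : Name → List Name → List Cell → Set where
  leaf : ∀ r → KTree r (r ∷ []) []
  cowk : ∀ r → KTree r [] (coweak r ∷ [])
  node : ∀ {r a b la lb ca cb} → KTree a la ca → KTree b lb cb →
         KTree r (la ++ lb) (cocontr r a b ∷ ca ++ cb)

-- N is (a representative of) the routing area (I, O, R), with I = Fin m, O = Fin n.
record IsRouting {m n : ℕ} (R : Fin m → Fin n → ℕ) (N : Net m n) : Set where
  field
    wf      : WF N
    noLoops : loops N ≡ 0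
    inT     : Fin m → List Cell
    inL     : Fin m → List Name
    inTree  : ∀ i → CTree (ins N i) (inL i) (inT i)
    outT    : Fin n → List Cell
    outL    : Fin n → List Name
    outTree : ∀ o → KTree (outs N o) (outL o) (outT o)
    W       : Fin m → Fin n → List Name     -- the R(i,o) wires between i and o
    W-len   : ∀ i o → length (W i o) ≡ R i o
    inL-W   : ∀ i → inL i ↭ concat (map (W i) (allFin n))
    outL-W  : ∀ o → outL o ↭ concat (map (λ i → W i o) (allFin m))
    cells-T : cells N ↭ concat (map inT (allFin m)) ++ concat (map outT (allFin n))

-- Connecting input i with output o; remaining labels I∖{i}, O∖{o}
-- are identified with Fin m, Fin n via punchIn.
connect : ∀ {m n} → Net (suc m) (suc n) → Fin (suc m) → Fin (suc n) → Net m n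
connect (net cs ι ω l) i o =
  if ι i ≡ᵇ ω o
  then net cs (λ k → ι (punchIn i k)) (λ k → ω (punchIn o k)) (suc l)
  else rename (ω o ↦ₙ ι i) (net cs (λ k → ι (punchIn i k)) (λ k → ω (punchIn o k)) l)

Tof : ∀ {m n} → (Fin (suc m) → Fin (suc n) → ℕ) → Fin (suc m) → Fin (suc n) →
      Fin m → Fin n → ℕ
Tof R i o x y = R (punchIn i x) (punchIn o y) + R (punchIn i x) o * R i (punchIn o y)

module Submission where

-- Connecting i with o identifies the root wire of the contraction tree of i with
-- the root wire of the cocontraction tree of o, and R i o = 0 makes these two wires
-- distinct, so the result is a well-formed net in which the two trees face each
-- other.  By (ba), (s1), (s2), (ε), a contraction tree with leaves L facing a
-- cocontraction tree with leaves L' becomes |L'| contraction trees (columns) and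
-- |L| cocontraction trees (rows), every column joined to every row by one wire.
-- Here L are the wires from i to the other outputs y and L' the wires from the
-- other inputs x to o; the column at a wire x–o grafts onto the tree of x and the
-- row at a wire i–y onto the tree of y, so x and y gain R(x,o)·R(i,y) new wires.
-- Wires are names and (ba) creates new ones, so every reduction carries a bound
-- above which names are unused.

open import Defs
open import Data.Nat using (ℕ; zero; suc; _+_; _*_; _∸_; _⊔_; _≡ᵇ_; _≤_; _<_; z≤n; s≤s; s≤s⁻¹)
open import Data.Nat.Properties
open import Data.Nat.Tactic.RingSolver using (solve-∀)
open import Data.Bool using (true; false; if_then_else_)
open import Data.Fin using (Fin; punchIn) renaming (zero to fzero; suc to fsuc)
open import Data.List using (List; []; _∷_; _++_; map; concat; concatMap; length; allFin; tabulate; foldr)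
import Data.List.Properties as List
open import Data.List.Relation.Binary.Permutation.Propositional as ↭
  using (_↭_; prep; swap; ↭-refl; ↭-sym; ↭-trans; ↭-reflexive)
open import Data.List.Relation.Binary.Permutation.Propositional.Properties
  using (++⁺ˡ; ++⁺ʳ; ++⁺; shifts; ++-comm; map⁺; All-resp-↭; ++-commutativeMonoid)
open import Data.List.Relation.Unary.All as All using (All; []; _∷_)
import Data.List.Relation.Unary.All.Properties as All
open import Data.List.Relation.Unary.AllPairs using ([]; _∷_)
open import Data.Sum using (_⊎_; inj₁; inj₂)
open import Data.Product using (Σ; ∃; _×_; _,_; proj₁; proj₂)
open import Data.Empty using (⊥-elim)
open import Function using (_∘_)
open import Relation.Binary.PropositionalEquality
  using (_≡_; _≢_; refl; sym; trans; cong; cong₂; subst; subst₂; module ≡-Reasoning)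
open import Relation.Binary.Construct.Closure.ReflexiveTransitive using (ε; _◅_; _◅◅_)
import Algebra.Solver.CommutativeMonoid as CommutativeMonoidSolver

-- Permutations and families over lists

module ↭-Cells = CommutativeMonoidSolver (++-commutativeMonoid {A = Cell})
open ↭-Cells using (solve; _⊕_; _⊜_)

concatMap-[] : ∀ {A B : Set} (xs : List A) → concatMap (λ _ → [] {A = B}) xs ≡ []
concatMap-[] []       = refl
concatMap-[] (x ∷ xs) = concatMap-[] xs

module _ {A B : Set} where

  concatMap-↭ : (f : A → List B) {xs ys : List A} → xs ↭ ys → concatMap f xs ↭ concatMap f ys
  concatMap-↭ f ↭.refl        = ↭-refl
  concatMap-↭ f (prep x p)    = ++⁺ˡ (f x) (concatMap-↭ f p)
  concatMap-↭ f (swap x y p)  = ↭-trans (shifts (f x) (f y)) (++⁺ˡ (f y) (++⁺ˡ (f x) (concatMap-↭ f p)))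
  concatMap-↭ f (↭.trans p q) = ↭-trans (concatMap-↭ f p) (concatMap-↭ f q)

  concatMap-cong-↭ : {f g : A → List B} (xs : List A) → (∀ x → f x ↭ g x) →
    concatMap f xs ↭ concatMap g xs
  concatMap-cong-↭ []       f↭g = ↭-refl
  concatMap-cong-↭ (x ∷ xs) f↭g = ++⁺ (f↭g x) (concatMap-cong-↭ xs f↭g)

  concatMap-++-↭ : (f g : A → List B) (xs : List A) →
    concatMap (λ x → f x ++ g x) xs ↭ concatMap f xs ++ concatMap g xs
  concatMap-++-↭ f g []       = ↭-refl
  concatMap-++-↭ f g (x ∷ xs) = ↭-trans (++⁺ˡ (f x ++ g x) (concatMap-++-↭ f g xs))
    (↭-trans (↭-reflexive (List.++-assoc (f x) (g x) _))
    (↭-trans (++⁺ˡ (f x) (shifts (g x) (concatMap f xs)))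
             (↭-reflexive (sym (List.++-assoc (f x) (concatMap f xs) _)))))

  map-as-concatMap : (f : A → B) (xs : List A) → map f xs ≡ concatMap (λ x → f x ∷ []) xs
  map-as-concatMap f xs = trans (sym (List.concatMap-pure (map f xs))) (List.concatMap-map (_∷ []) f xs)

  length-concatMap : (f : A → List B) (xs : List A) {c : ℕ} → (∀ x → length (f x) ≡ c) →
    length (concatMap f xs) ≡ length xs * c
  length-concatMap f []       eq = refl
  length-concatMap f (x ∷ xs) eq =
    trans (List.length-++ (f x)) (cong₂ _+_ (eq x) (length-concatMap f xs eq))

module _ {A B C : Set} where

  concatMap-comm-↭ : (H : A → B → List C) (as : List A) (bs : List B) →
    concatMap (λ a → concatMap (H a) bs) as ↭ concatMap (λ b → concatMap (λ a → H a b) as) bs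
  concatMap-comm-↭ H []       bs = ↭-reflexive (sym (concatMap-[] bs))
  concatMap-comm-↭ H (a ∷ as) bs = ↭-trans (++⁺ˡ (concatMap (H a) bs) (concatMap-comm-↭ H as bs))
    (↭-sym (concatMap-++-↭ (H a) (λ b → concatMap (λ a → H a b) as) bs))

  concatMap-concatMap : (f : B → List C) (g : A → List B) (xs : List A) →
    concatMap f (concatMap g xs) ≡ concatMap (λ x → concatMap f (g x)) xs
  concatMap-concatMap f g []       = refl
  concatMap-concatMap f g (x ∷ xs) =
    trans (List.concatMap-++ f (g x) (concatMap g xs)) (cong (concatMap f (g x) ++_) (concatMap-concatMap f g xs))

allFin-↭-punchIn : ∀ {k} (i : Fin (suc k)) → allFin (suc k) ↭ i ∷ map (punchIn i) (allFin k)
allFin-↭-punchIn {k}     fzero    = ↭-reflexive (cong (fzero ∷_) (sym (List.map-tabulate (λ x → x) fsuc)))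
allFin-↭-punchIn {suc k} (fsuc i) =
  ↭-trans (↭-reflexive (cong (fzero ∷_) (sym (List.map-tabulate (λ x → x) fsuc))))
  (↭-trans (prep fzero (map⁺ fsuc (allFin-↭-punchIn i)))
  (↭-trans (swap fzero (fsuc i) ↭-refl) (prep (fsuc i) (prep fzero (↭-reflexive shifted)))))
  where
  shifted : map fsuc (map (punchIn i) (allFin k)) ≡ map (punchIn (fsuc i)) (tabulate fsuc)
  shifted = trans (sym (List.map-∘ (allFin k)))
    (trans (List.map-tabulate (λ x → x) (fsuc ∘ punchIn i)) (sym (List.map-tabulate fsuc (punchIn (fsuc i)))))

module _ {X : Set} {k : ℕ} where

  map-allFin-punchIn : (h : Fin (suc k) → X) (i : Fin (suc k)) →
    map h (allFin (suc k)) ↭ h i ∷ map (h ∘ punchIn i) (allFin k)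
  map-allFin-punchIn h i =
    ↭-trans (map⁺ h (allFin-↭-punchIn i)) (prep (h i) (↭-reflexive (sym (List.map-∘ (allFin k)))))

  concatMap-allFin-punchIn : (h : Fin (suc k) → List X) (i : Fin (suc k)) →
    concatMap h (allFin (suc k)) ↭ h i ++ concatMap (h ∘ punchIn i) (allFin k)
  concatMap-allFin-punchIn h i = ↭-trans (concatMap-↭ h (allFin-↭-punchIn i))
    (++⁺ˡ (h i) (↭-reflexive (List.concatMap-map h (punchIn i) (allFin k))))

reduce-++⁺ : ∀ {A B : Set} {P : A → Set} (f : ∀ {x} → P x → B) {xs ys} (ps : All P xs) (qs : All P ys) →
  All.reduce f (All.++⁺ ps qs) ≡ All.reduce f ps ++ All.reduce f qs
reduce-++⁺ f []       qs = refl
reduce-++⁺ f (p ∷ ps) qs = cong (f p ∷_) (reduce-++⁺ f ps qs)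

module _ {A B : Set} {P : A → Set} (f : ∀ {x} → P x → List B) where

  concatAll : ∀ {xs} → All P xs → List B
  concatAll []       = []
  concatAll (p ∷ ps) = f p ++ concatAll ps

  concatAll-++⁺ : ∀ {xs ys} (ps : All P xs) (qs : All P ys) →
    concatAll (All.++⁺ ps qs) ≡ concatAll ps ++ concatAll qs
  concatAll-++⁺ []       qs = refl
  concatAll-++⁺ (p ∷ ps) qs = trans (cong (f p ++_) (concatAll-++⁺ ps qs)) (sym (List.++-assoc (f p) _ _))

  concatAll-++⁻ : ∀ xs {ys} (ps : All P (xs ++ ys)) →
    concatAll ps ≡ concatAll (All.++⁻ˡ xs ps) ++ concatAll (All.++⁻ʳ xs ps)
  concatAll-++⁻ []       ps       = refl
  concatAll-++⁻ (x ∷ xs) (p ∷ ps) = trans (cong (f p ++_) (concatAll-++⁻ xs ps)) (sym (List.++-assoc (f p) _ _))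

  concatAll-resp-↭ : ∀ {xs ys} (p : xs ↭ ys) (ps : All P xs) → concatAll (All-resp-↭ p ps) ↭ concatAll ps
  concatAll-resp-↭ ↭.refl        ps           = ↭-refl
  concatAll-resp-↭ (prep x p)    (q ∷ ps)     = ++⁺ˡ (f q) (concatAll-resp-↭ p ps)
  concatAll-resp-↭ (swap x y p)  (q ∷ r ∷ ps) =
    ↭-trans (shifts (f r) (f q)) (++⁺ˡ (f q) (++⁺ˡ (f r) (concatAll-resp-↭ p ps)))
  concatAll-resp-↭ (↭.trans p q) ps           = ↭-trans (concatAll-resp-↭ q (All-resp-↭ p ps)) (concatAll-resp-↭ p ps)

restrictAll : ∀ {A : Set} {P : A → Set} {k} (h : Fin k → List A) →
  All P (concatMap h (allFin k)) → (x : Fin k) → All P (h x)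
restrictAll {P = P} {k} h ps = All.tabulate⁻ {f = h} (All.concat⁻ {xss = tabulate h}
  (subst (All P) (cong concat (List.map-tabulate {n = k} (λ x → x) h)) ps))

module _ {A B : Set} {P : A → Set} where

  reduce-as-concatAll : (f : ∀ {x} → P x → B) {xs : List A} (ps : All P xs) →
    All.reduce f ps ≡ concatAll (λ p → f p ∷ []) ps
  reduce-as-concatAll f []       = refl
  reduce-as-concatAll f (p ∷ ps) = cong (f p ∷_) (reduce-as-concatAll f ps)

  concatAll-map : {Q : A → Set} (e : ∀ {x} → P x → List B) (g : ∀ {x} → Q x → P x) {xs : List A} (qs : All Q xs) →
    concatAll e (All.map g qs) ≡ concatAll (e ∘ g) qs
  concatAll-map e g []       = refl
  concatAll-map e g (q ∷ qs) = cong (e (g q) ++_) (concatAll-map e g qs)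

  concatAll-reduce : {C : Set} (h : C → List B) (f : ∀ {x} → P x → C) {xs : List A} (ps : All P xs) →
    concatAll (h ∘ f) ps ≡ concatMap h (All.reduce f ps)
  concatAll-reduce h f []       = refl
  concatAll-reduce h f (p ∷ ps) = cong (h (f p) ++_) (concatAll-reduce h f ps)

  length-reduce : (f : ∀ {x} → P x → B) {xs : List A} (ps : All P xs) → length (All.reduce f ps) ≡ length xs
  length-reduce f []       = refl
  length-reduce f (p ∷ ps) = cong suc (length-reduce f ps)

  concatAll-concat⁻ : (e : ∀ {x} → P x → List B) {k : ℕ} (F : Fin k → List A)
    (ps : All P (concat (tabulate F))) →
    concatAll e ps ≡ concat (tabulate λ x → concatAll e (All.tabulate⁻ {f = F} (All.concat⁻ {xss = tabulate F} ps) x))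
  concatAll-concat⁻ e {zero}  F [] = refl
  concatAll-concat⁻ e {suc k} F ps = trans (concatAll-++⁻ e (F fzero) ps)
    (cong (concatAll e (All.++⁻ˡ (F fzero) ps) ++_) (concatAll-concat⁻ e (F ∘ fsuc) (All.++⁻ʳ (F fzero) ps)))

  concatAll-restrictAll : (e : ∀ {x} → P x → List B) {k : ℕ} (h : Fin k → List A)
    (ps : All P (concatMap h (allFin k))) →
    concatAll e ps ≡ concatMap (λ x → concatAll e (restrictAll h ps x)) (allFin k)
  concatAll-restrictAll e h ps = trans (sym (concatAll-subst eq ps))
    (trans (concatAll-concat⁻ e h (subst (All P) eq ps))
           (cong concat (sym (List.map-tabulate (λ x → x) (λ x → concatAll e (restrictAll h ps x))))))
    where
    eq = cong concat (List.map-tabulate (λ x → x) h)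
    concatAll-subst : ∀ {xs ys} (q : xs ≡ ys) (qs : All P xs) → concatAll e (subst (All P) q qs) ≡ concatAll e qs
    concatAll-subst refl qs = refl

-- Occurrences of names

-- cnt v (x ∷ xs) unfolds to δ v x + cnt v xs.
δ : Name → Name → ℕ
δ x y = if x ≡ᵇ y then 1 else 0

≡ᵇ-cases : ∀ x y → (x ≡ y × (x ≡ᵇ y) ≡ true) ⊎ (x ≢ y × (x ≡ᵇ y) ≡ false)
≡ᵇ-cases zero    zero    = inj₁ (refl , refl)
≡ᵇ-cases zero    (suc y) = inj₂ ((λ ()) , refl)
≡ᵇ-cases (suc x) zero    = inj₂ ((λ ()) , refl)
≡ᵇ-cases (suc x) (suc y) with ≡ᵇ-cases x y
... | inj₁ (x≡y , p) = inj₁ (cong suc x≡y , p)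
... | inj₂ (x≢y , p) = inj₂ ((λ e → x≢y (suc-injective e)) , p)

δ-cases : ∀ v x → (v ≡ x × δ v x ≡ 1) ⊎ (v ≢ x × δ v x ≡ 0)
δ-cases v x with ≡ᵇ-cases v x
... | inj₁ (v≡x , p) = inj₁ (v≡x , cong (λ b → if b then 1 else 0) p)
... | inj₂ (v≢x , p) = inj₂ (v≢x , cong (λ b → if b then 1 else 0) p)

δ-refl : ∀ v → δ v v ≡ 1
δ-refl zero    = refl
δ-refl (suc v) = δ-refl v

δ-≢ : ∀ {v x} → v ≢ x → δ v x ≡ 0
δ-≢ {v} {x} v≢x with δ-cases v x
... | inj₁ (v≡x , _) = ⊥-elim (v≢x v≡x)
... | inj₂ (_ , p)   = p

cnt-++ : ∀ v (xs ys : List Name) → cnt v (xs ++ ys) ≡ cnt v xs + cnt v ys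
cnt-++ v []       ys = refl
cnt-++ v (x ∷ xs) ys = trans (cong (δ v x +_) (cnt-++ v xs ys)) (sym (+-assoc (δ v x) _ _))

cnt-↭ : ∀ v {xs ys : List Name} → xs ↭ ys → cnt v xs ≡ cnt v ys
cnt-↭ v ↭.refl         = refl
cnt-↭ v (prep x p)     = cong (δ v x +_) (cnt-↭ v p)
cnt-↭ v (swap {xs} {ys} x y p) = begin
  δ v x + (δ v y + cnt v xs)  ≡⟨ sym (+-assoc (δ v x) _ _) ⟩
  δ v x + δ v y + cnt v xs    ≡⟨ cong₂ _+_ (+-comm (δ v x) (δ v y)) (cnt-↭ v p) ⟩
  δ v y + δ v x + cnt v ys    ≡⟨ +-assoc (δ v y) _ _ ⟩
  δ v y + (δ v x + cnt v ys)  ∎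
  where open ≡-Reasoning
cnt-↭ v (↭.trans p q)  = trans (cnt-↭ v p) (cnt-↭ v q)

cnt-head-pos : ∀ v xs → 1 ≤ cnt v (v ∷ xs)
cnt-head-pos v xs = subst (λ d → 1 ≤ d + cnt v xs) (sym (δ-refl v)) (s≤s z≤n)

cnt-≤-++ˡ : ∀ v (xs ys : List Name) → cnt v xs ≤ cnt v (xs ++ ys)
cnt-≤-++ˡ v xs ys = subst (cnt v xs ≤_) (sym (cnt-++ v xs ys)) (m≤m+n _ _)

cellNames : List Cell → List Name
cellNames = concatMap namesC

cellNames-++ : ∀ (xs ys : List Cell) → cellNames (xs ++ ys) ≡ cellNames xs ++ cellNames ys
cellNames-++ = List.concatMap-++ namesC

cnt-cellNames-++ : ∀ v (ca cb : List Cell) →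
  cnt v (cellNames (ca ++ cb)) ≡ cnt v (cellNames ca) + cnt v (cellNames cb)
cnt-cellNames-++ v ca cb = trans (cong (cnt v) (cellNames-++ ca cb)) (cnt-++ v (cellNames ca) (cellNames cb))

netNames : ∀ {m n} → Net m n → List Name
netNames N = cellNames (cells N) ++ map (ins N) (allFin _) ++ map (outs N) (allFin _)

occ-++ : ∀ {m n} (A rest : List Cell) (ι : Fin m → Name) (ω : Fin n → Name) l v →
  occ v (net (A ++ rest) ι ω l) ≡ cnt v (cellNames A) + occ v (net rest ι ω l)
occ-++ A rest ι ω l v = trans (cong (λ xs → cnt v (xs ++ _)) (cellNames-++ A rest))
  (trans (cong (cnt v) (List.++-assoc (cellNames A) (cellNames rest) _)) (cnt-++ v (cellNames A) _))

ZeroOrTwo : ℕ → Set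
ZeroOrTwo c = c ≡ 0 ⊎ c ≡ 2

FreshFrom : ℕ → List Name → Set
FreshFrom k xs = ∀ v → k ≤ v → cnt v xs ≡ 0

fresh-above-max : ∀ xs → FreshFrom (suc (foldr _⊔_ 0 xs)) xs
fresh-above-max []       v _   = refl
fresh-above-max (x ∷ xs) v max<v = cong₂ _+_
  (δ-≢ (λ v≡x → <⇒≢ (≤-trans (s≤s (m≤m⊔n x _)) max<v) (sym v≡x)))
  (fresh-above-max xs v (≤-trans (s≤s (m≤n⊔m x _)) max<v))

occ-↭ : ∀ {m n} {cs cs' : List Cell} (ι : Fin m → Name) (ω : Fin n → Name) l → cs ↭ cs' →
  ∀ v → occ v (net cs ι ω l) ≡ occ v (net cs' ι ω l)
occ-↭ ι ω l p v = cnt-↭ v (++⁺ʳ _ (concatMap-↭ namesC p))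

WF-↭ : ∀ {m n} {cs cs' : List Cell} (ι : Fin m → Name) (ω : Fin n → Name) l → cs ↭ cs' →
  WF (net cs ι ω l) → WF (net cs' ι ω l)
WF-↭ ι ω l p wf v = subst ZeroOrTwo (occ-↭ ι ω l p v) (wf v)

δ-≤-cnt-map : ∀ {k} (h : Fin k → Name) x v → δ v (h x) ≤ cnt v (map h (allFin k))
δ-≤-cnt-map {suc k} h x v = subst (δ v (h x) ≤_) (sym (cnt-↭ v (map-allFin-punchIn h x))) (m≤m+n _ _)

cnt-≤-concatMap : ∀ {k} (h : Fin k → List Name) x v → cnt v (h x) ≤ cnt v (concatMap h (allFin k))
cnt-≤-concatMap {suc k} h x v =
  subst (cnt v (h x) ≤_) (sym (cnt-↭ v (concatMap-allFin-punchIn h x))) (cnt-≤-++ˡ v (h x) _)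

cnt-cells-≤ : ∀ {k} (h : Fin k → List Cell) x v →
  cnt v (cellNames (h x)) ≤ cnt v (cellNames (concatMap h (allFin k)))
cnt-cells-≤ {k} h x v = subst (cnt v (cellNames (h x)) ≤_)
  (cong (cnt v) (sym (concatMap-concatMap namesC h (allFin k)))) (cnt-≤-concatMap (cellNames ∘ h) x v)

ZeroOrTwo⇒≤2 : ∀ {c} → ZeroOrTwo c → c ≤ 2
ZeroOrTwo⇒≤2 (inj₁ refl) = z≤n
ZeroOrTwo⇒≤2 (inj₂ refl) = ≤-refl

half-≤1 : ∀ c → c + c ≤ 2 → c ≤ 1
half-≤1 0             _ = z≤n
half-≤1 1             _ = ≤-refl
half-≤1 (suc (suc c)) (s≤s (s≤s p)) with ≤-trans (m≤n+m (suc (suc c)) c) p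
... | ()

cnt-mono-concatMap : ∀ {A : Set} {v} {f g : A → List Name} xs → (∀ x → cnt v (f x) ≤ cnt v (g x)) →
  cnt v (concatMap f xs) ≤ cnt v (concatMap g xs)
cnt-mono-concatMap         []       f≤g = z≤n
cnt-mono-concatMap {v = v} {f} {g} (x ∷ xs) f≤g =
  subst₂ _≤_ (sym (cnt-++ v (f x) _)) (sym (cnt-++ v (g x) _)) (+-mono-≤ (f≤g x) (cnt-mono-concatMap xs f≤g))

Distinct : List Name → Set
Distinct L = ∀ v → cnt v L ≤ 1

occurs-self : ∀ L → All (λ l → 1 ≤ cnt l L) L
occurs-self []       = []
occurs-self (x ∷ xs) = cnt-head-pos x xs ∷ All.map (λ {y} p → ≤-trans p (m≤n+m (cnt y xs) (δ y x))) (occurs-self xs)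

distinct-disjoint : ∀ la lb → Distinct (la ++ lb) → All (λ l → cnt l la ≡ 0) lb
distinct-disjoint la lb d = All.map (λ {l} → absent l) (occurs-self lb)
  where
  absent : ∀ l → 1 ≤ cnt l lb → cnt l la ≡ 0
  absent l p with cnt l la | subst (_≤ 1) (cnt-++ l la lb) (d l)
  ... | zero  | _  = refl
  ... | suc c | ≤1 = ⊥-elim (1+n≰n (≤-trans (+-mono-≤ {1} {suc c} (s≤s z≤n) p) ≤1))

distinct-++ˡ : ∀ la lb → Distinct (la ++ lb) → Distinct la
distinct-++ˡ la lb d v = ≤-trans (m≤m+n (cnt v la) (cnt v lb)) (subst (_≤ 1) (cnt-++ v la lb) (d v))

distinct-++ʳ : ∀ la lb → Distinct (la ++ lb) → Distinct lb
distinct-++ʳ la lb d v = ≤-trans (m≤n+m (cnt v lb) (cnt v la)) (subst (_≤ 1) (cnt-++ v la lb) (d v))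

-- Reduction inside a context

record Reduct {m n} (N N' : Net m n) (k : ℕ) : Set where
  constructor reduct
  field
    steps : N ⇒* N'
    wf    : WF N'
    fresh : FreshFrom k (netNames N')

-- The cells A reduce to B inside any well-formed context in which the names ≥ k
-- are unused (so that (ba) may draw its new wires from there); afterwards the
-- names ≥ k' are unused.
record Reduces (k k' : ℕ) (A B : List Cell) : Set where
  constructor reduces
  field
    run : ∀ {m n} (rest : List Cell) (ι : Fin m → Name) (ω : Fin n → Name) l →
          FreshFrom k (netNames (net (A ++ rest) ι ω l)) → WF (net (A ++ rest) ι ω l) →
          Reduct (net (A ++ rest) ι ω l) (net (B ++ rest) ι ω l) k'
open Reduces

reduces-refl : ∀ {k A} → Reduces k k A A
reduces-refl = reduces λ rest ι ω l fresh wf → reduct ε wf fresh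

reduces-trans : ∀ {k k' k'' A B C} → Reduces k k' A B → Reduces k' k'' B C → Reduces k k'' A C
reduces-trans A⟶B B⟶C = reduces λ rest ι ω l fresh wf →
  let reduct s₁ wf₁ fresh₁ = run A⟶B rest ι ω l fresh wf
      reduct s₂ wf₂ fresh₂ = run B⟶C rest ι ω l fresh₁ wf₁
  in reduct (s₁ ◅◅ s₂) wf₂ fresh₂

steps-↭ : ∀ {m n} {cs cs' : List Cell} (ι : Fin m → Name) (ω : Fin n → Name) l → cs ↭ cs' →
  net cs ι ω l ⇒* net cs' ι ω l
steps-↭ ι ω l p = ≈→ (perm p) ◅ ε

reduces-↭ : ∀ {k k' A A' B B'} → A ↭ A' → Reduces k k' A' B' → B' ↭ B → Reduces k k' A B
reduces-↭ A↭A' A'⟶B' B'↭B = reduces λ rest ι ω l fresh wf →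
  let pA = ++⁺ʳ rest A↭A'
      pB = ++⁺ʳ rest B'↭B
      reduct s wf' fresh' = run A'⟶B' rest ι ω l
        (λ v k≤v → trans (sym (occ-↭ ι ω l pA v)) (fresh v k≤v)) (WF-↭ ι ω l pA wf)
  in reduct (steps-↭ ι ω l pA ◅◅ s ◅◅ steps-↭ ι ω l pB) (WF-↭ ι ω l pB wf')
            (λ v k≤v → trans (sym (occ-↭ ι ω l pB v)) (fresh' v k≤v))

reduces-frameʳ : ∀ {k k' A B} X → Reduces k k' A B → Reduces k k' (A ++ X) (B ++ X)
reduces-frameʳ {A = A} {B} X A⟶B = reduces λ rest ι ω l →
  subst₂ (λ A' B' → FreshFrom _ (netNames (net A' ι ω l)) → WF (net A' ι ω l) →
                    Reduct (net A' ι ω l) (net B' ι ω l) _)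
    (sym (List.++-assoc A X rest)) (sym (List.++-assoc B X rest)) (run A⟶B (X ++ rest) ι ω l)

reduces-frameˡ : ∀ {k k' A B} X → Reduces k k' A B → Reduces k k' (X ++ A) (X ++ B)
reduces-frameˡ {A = A} {B} X A⟶B = reduces-↭ (++-comm X A) (reduces-frameʳ X A⟶B) (++-comm B X)

data OccChange (k : ℕ) (A B : List Cell) (v : Name) : Set where
  same    : cnt v (cellNames A) ≡ cnt v (cellNames B) → OccChange k A B v
  erased  : cnt v (cellNames A) ≡ 2 + cnt v (cellNames B) → OccChange k A B v
  created : k ≤ v → (cnt v (cellNames A) ≡ 0 → ZeroOrTwo (cnt v (cellNames B))) → OccChange k A B v

-- These conditions make a local rewrite preserve well-formedness in every context.
record Rewriting (k k' : ℕ) (A B : List Cell) : Set where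
  field
    occChange  : ∀ v → OccChange k A B v
    keepsFresh : ∀ v → k' ≤ v → cnt v (cellNames A) ≡ 0 → cnt v (cellNames B) ≡ 0

module _ {k k' : ℕ} {A B : List Cell} (rw : Rewriting k k' A B)
         {m n} (rest : List Cell) (ι : Fin m → Name) (ω : Fin n → Name) (l : ℕ)
         (fresh : FreshFrom k (netNames (net (A ++ rest) ι ω l))) where
  private
    a b c : Name → ℕ
    a v = cnt v (cellNames A)
    b v = cnt v (cellNames B)
    c v = occ v (net rest ι ω l)

    absent : ∀ v → k ≤ v → a v + c v ≡ 0
    absent v k≤v = trans (sym (occ-++ A rest ι ω l v)) (fresh v k≤v)

    balance : ∀ v → OccChange k A B v → ZeroOrTwo (a v + c v) → ZeroOrTwo (b v + c v)
    balance v (same eq) z = subst (λ t → ZeroOrTwo (t + c v)) eq z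
    balance v (erased eq) z with a v | eq | z
    ... | _ | refl | inj₂ two = inj₁ (suc-injective (suc-injective two))
    balance v (created k≤v new) _ =
      subst ZeroOrTwo (sym (trans (cong (b v +_) (m+n≡0⇒n≡0 (a v) (absent v k≤v))) (+-identityʳ (b v))))
        (new (m+n≡0⇒m≡0 (a v) (absent v k≤v)))

  rewriting-WF : WF (net (A ++ rest) ι ω l) → WF (net (B ++ rest) ι ω l)
  rewriting-WF wf v = subst ZeroOrTwo (sym (occ-++ B rest ι ω l v))
    (balance v (Rewriting.occChange rw v) (subst ZeroOrTwo (occ-++ A rest ι ω l v) (wf v)))

  rewriting-fresh : k ≤ k' → FreshFrom k' (netNames (net (B ++ rest) ι ω l))
  rewriting-fresh k≤k' v k'≤v = trans (occ-++ B rest ι ω l v)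
    (cong₂ _+_ (Rewriting.keepsFresh rw v k'≤v (m+n≡0⇒m≡0 (a v) none)) (m+n≡0⇒n≡0 (a v) none))
    where none = absent v (≤-trans k≤k' k'≤v)

reduces-step : ∀ {k k' A B} → k ≤ k' →
  (∀ {m n} rest (ι : Fin m → Name) (ω : Fin n → Name) l →
     FreshFrom k (netNames (net (A ++ rest) ι ω l)) → WF (net (A ++ rest) ι ω l) →
     net (A ++ rest) ι ω l ↦ net (B ++ rest) ι ω l) →
  Rewriting k k' A B → Reduces k k' A B
reduces-step k≤k' step rw = reduces λ rest ι ω l fresh wf →
  reduct (red (step rest ι ω l fresh wf) ◅ ε)
         (rewriting-WF rw rest ι ω l fresh wf) (rewriting-fresh rw rest ι ω l fresh k≤k')

principal : Cell → Name
principal (contr a _ _)   = a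
principal (weak a)        = a
principal (cocontr a _ _) = a
principal (coweak a)      = a

occ-principal : ∀ {m n} c cs (ι : Fin m → Name) (ω : Fin n → Name) l →
  WF (net (c ∷ cs) ι ω l) → occ (principal c) (net (c ∷ cs) ι ω l) ≡ 2
occ-principal c cs ι ω l wf with wf (principal c)
... | inj₂ two  = two
... | inj₁ none = ⊥-elim (1+n≰n (subst (1 ≤_) none (head-pos c)))
  where
  names = cellNames cs ++ map ι (allFin _) ++ map ω (allFin _)
  head-pos : ∀ c → 1 ≤ occ (principal c) (net (c ∷ cs) ι ω l)
  head-pos (contr a b c)   = cnt-head-pos a (b ∷ c ∷ names)
  head-pos (weak a)        = cnt-head-pos a names
  head-pos (cocontr a b c) = cnt-head-pos a (b ∷ c ∷ names)
  head-pos (coweak a)      = cnt-head-pos a names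

occChange-cut : ∀ {k A B} x v →
  cnt v (cellNames A) ≡ δ v x + (δ v x + cnt v (cellNames B)) → OccChange k A B v
occChange-cut x v cut with δ-cases v x
... | inj₁ (_ , p) = erased (trans cut (cong (λ d → d + (d + _)) p))
... | inj₂ (_ , p) = same (trans cut (cong (λ d → d + (d + _)) p))

rewriting-cut : ∀ {k A B} (x : Name) →
  (∀ v → cnt v (cellNames A) ≡ δ v x + (δ v x + cnt v (cellNames B))) → Rewriting k k A B
rewriting-cut x cut = record
  { occChange  = λ v → occChange-cut x v (cut v)
  ; keepsFresh = λ v _ none → m+n≡0⇒n≡0 (δ v x) (m+n≡0⇒n≡0 (δ v x) (trans (sym (cut v)) none))
  }

reduces-ε : ∀ {k x} → Reduces k k (coweak x ∷ weak x ∷ []) []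
reduces-ε {x = x} = reduces-step ≤-refl
  (λ rest ι ω l _ wf → eps (occ-principal (coweak x) (weak x ∷ rest) ι ω l wf))
  (rewriting-cut x (λ _ → refl))

reduces-s1 : ∀ {k x y z} → Reduces k k (coweak x ∷ contr x y z ∷ []) (coweak y ∷ coweak z ∷ [])
reduces-s1 {x = x} {y} {z} = reduces-step ≤-refl
  (λ rest ι ω l _ wf → s1 (occ-principal (coweak x) (contr x y z ∷ rest) ι ω l wf))
  (rewriting-cut x (λ _ → refl))

reduces-s2 : ∀ {k x y z} → Reduces k k (cocontr x y z ∷ weak x ∷ []) (weak y ∷ weak z ∷ [])
reduces-s2 {x = x} {y} {z} = reduces-step ≤-refl
  (λ rest ι ω l _ wf → s2 (occ-principal (cocontr x y z) (weak x ∷ rest) ι ω l wf))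
  (rewriting-cut x cut)
  where
  shuffle : ∀ a b c → a + (b + (c + (a + 0))) ≡ a + (a + (b + (c + 0)))
  shuffle = solve-∀
  cut : ∀ v → δ v x + (δ v y + (δ v z + (δ v x + 0))) ≡ δ v x + (δ v x + (δ v y + (δ v z + 0)))
  cut v = shuffle (δ v x) (δ v y) (δ v z)

δ-+ : ∀ k u v → δ (k + u) (k + v) ≡ δ u v
δ-+ zero    u v = refl
δ-+ (suc k) u v = δ-+ k u v

+-≢ : ∀ k {u v} → u ≢ v → k + u ≢ k + v
+-≢ k u≢v eq = u≢v (+-cancelˡ-≡ k _ _ eq)

-- (ba) takes its four new wires k, k+1, k+2, k+3 from the names known to be unused.
module BetaAlpha (k x y₁ y₂ z₁ z₂ : Name) where

  redex contractum : List Cell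
  redex      = contr x y₁ y₂ ∷ cocontr x z₁ z₂ ∷ []
  contractum = cocontr y₁ (k + 0) (k + 1) ∷ cocontr y₂ (k + 2) (k + 3)
             ∷ contr z₁ (k + 0) (k + 2) ∷ contr z₂ (k + 1) (k + 3) ∷ []

  private
    auxCount newCount : Name → ℕ
    auxCount v = δ v y₁ + (δ v y₂ + (δ v z₁ + δ v z₂))
    newCount v = (δ v (k + 0) + δ v (k + 1)) + (δ v (k + 2) + δ v (k + 3))

    newCount₀ : ℕ → ℕ
    newCount₀ j = (δ j 0 + δ j 1) + (δ j 2 + δ j 3)

    newCount₀≤1 : ∀ j → newCount₀ j ≡ 0 ⊎ newCount₀ j ≡ 1
    newCount₀≤1 0 = inj₂ refl
    newCount₀≤1 1 = inj₂ refl
    newCount₀≤1 2 = inj₂ refl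
    newCount₀≤1 3 = inj₂ refl
    newCount₀≤1 (suc (suc (suc (suc j)))) = inj₁ refl

    newCount₀-≥4 : ∀ j → 4 ≤ j → newCount₀ j ≡ 0
    newCount₀-≥4 (suc (suc (suc (suc j)))) _ = refl
    newCount₀-≥4 1 (s≤s ())
    newCount₀-≥4 2 (s≤s (s≤s ()))
    newCount₀-≥4 3 (s≤s (s≤s (s≤s ())))

    newCount-shift : ∀ j → newCount (k + j) ≡ newCount₀ j
    newCount-shift j rewrite δ-+ k j 0 | δ-+ k j 1 | δ-+ k j 2 | δ-+ k j 3 = refl

    newCount-below : ∀ v → v < k → newCount v ≡ 0
    newCount-below v v<k rewrite δ-≢ {v} {k + 0} (<⇒≢ (≤-trans v<k (m≤m+n k 0)))
                        | δ-≢ {v} {k + 1} (<⇒≢ (≤-trans v<k (m≤m+n k 1)))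
                        | δ-≢ {v} {k + 2} (<⇒≢ (≤-trans v<k (m≤m+n k 2)))
                        | δ-≢ {v} {k + 3} (<⇒≢ (≤-trans v<k (m≤m+n k 3))) = refl

    redex-count : ∀ a b c d e → a + (b + (c + (a + (d + (e + 0))))) ≡ a + (a + (b + (c + (d + e))))
    redex-count = solve-∀

    contractum-count : ∀ y₁ a b y₂ c d z₁ z₂ →
      y₁ + (a + (b + (y₂ + (c + (d + (z₁ + (a + (c + (z₂ + (b + (d + 0)))))))))))
        ≡ (y₁ + (y₂ + (z₁ + z₂))) + ((a + b) + (c + d)) * 2
    contractum-count = solve-∀

    cnt-redex : ∀ v → cnt v (cellNames redex) ≡ δ v x + (δ v x + auxCount v)
    cnt-redex v = redex-count (δ v x) (δ v y₁) (δ v y₂) (δ v z₁) (δ v z₂)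

    cnt-contractum : ∀ v → cnt v (cellNames contractum) ≡ auxCount v + newCount v * 2
    cnt-contractum v = contractum-count (δ v y₁) (δ v (k + 0)) (δ v (k + 1))
      (δ v y₂) (δ v (k + 2)) (δ v (k + 3)) (δ v z₁) (δ v z₂)

    auxCount-absent : ∀ v → cnt v (cellNames redex) ≡ 0 → auxCount v ≡ 0
    auxCount-absent v none = m+n≡0⇒n≡0 (δ v x) (m+n≡0⇒n≡0 (δ v x) (trans (sym (cnt-redex v)) none))

    change : ∀ v → OccChange k redex contractum v
    change v with <-≤-connex v k
    ... | inj₁ v<k = occChange-cut x v (trans (cnt-redex v)
      (cong (λ t → δ v x + (δ v x + t)) (sym (trans (cnt-contractum v)
        (trans (cong (λ t → auxCount v + t * 2) (newCount-below v v<k)) (+-identityʳ (auxCount v)))))))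
    ... | inj₂ k≤v = created k≤v λ none → subst ZeroOrTwo (sym (cnt-contractum v)) (twice none)
      where
      twice : cnt v (cellNames redex) ≡ 0 → ZeroOrTwo (auxCount v + newCount v * 2)
      twice none rewrite auxCount-absent v none | sym (m+[n∸m]≡n k≤v) | newCount-shift (v ∸ k) with newCount₀≤1 (v ∸ k)
      ... | inj₁ eq = inj₁ (cong (_* 2) eq)
      ... | inj₂ eq = inj₂ (cong (_* 2) eq)

    keepsFresh : ∀ v → k + 4 ≤ v → cnt v (cellNames redex) ≡ 0 → cnt v (cellNames contractum) ≡ 0
    keepsFresh v k+4≤v none rewrite cnt-contractum v | auxCount-absent v none
      | sym (m+[n∸m]≡n (≤-trans (m≤m+n k 4) k+4≤v)) | newCount-shift (v ∸ k)
      | newCount₀-≥4 (v ∸ k) (+-cancelˡ-≤ k 4 (v ∸ k)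
          (subst (k + 4 ≤_) (sym (m+[n∸m]≡n (≤-trans (m≤m+n k 4) k+4≤v))) k+4≤v)) = refl

  reduces-ba : Reduces k (k + 4) redex contractum
  reduces-ba = reduces-step (m≤m+n k 4)
    (λ rest ι ω l fresh wf → ba (occ-principal (contr x y₁ y₂) (cocontr x z₁ z₂ ∷ rest) ι ω l wf)
       ((+-≢ k (λ ()) ∷ +-≢ k (λ ()) ∷ +-≢ k (λ ()) ∷ []) ∷ (+-≢ k (λ ()) ∷ +-≢ k (λ ()) ∷ [])
         ∷ (+-≢ k (λ ()) ∷ []) ∷ [] ∷ [])
       (fresh (k + 0) (m≤m+n k 0) ∷ fresh (k + 1) (m≤m+n k 1) ∷ fresh (k + 2) (m≤m+n k 2)
         ∷ fresh (k + 3) (m≤m+n k 3) ∷ []))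
    (record { occChange = change ; keepsFresh = keepsFresh })

open BetaAlpha using (reduces-ba)

-- Trees: occurrences, grafting and renaming

node-leaves : ∀ v r a b (la lb : List Name) (ca cb : List Cell) →
  cnt v la ≤ δ v a + cnt v (cellNames ca) → cnt v lb ≤ δ v b + cnt v (cellNames cb) →
  cnt v (la ++ lb) + δ v r ≤ δ v r + (δ v a + (δ v b + cnt v (cellNames (ca ++ cb))))
node-leaves v r a b la lb ca cb ha hb = begin
  cnt v (la ++ lb) + δ v r
    ≡⟨ trans (cong (_+ δ v r) (cnt-++ v la lb)) (+-comm _ (δ v r)) ⟩
  δ v r + (cnt v la + cnt v lb)
    ≤⟨ +-monoʳ-≤ (δ v r) (+-mono-≤ ha hb) ⟩
  δ v r + ((δ v a + cnt v (cellNames ca)) + (δ v b + cnt v (cellNames cb)))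
    ≡⟨ cong (δ v r +_) (regroup (δ v a) (δ v b) _ _) ⟩
  δ v r + (δ v a + (δ v b + (cnt v (cellNames ca) + cnt v (cellNames cb))))
    ≡⟨ cong (λ t → δ v r + (δ v a + (δ v b + t))) (sym (cnt-cellNames-++ v ca cb)) ⟩
  δ v r + (δ v a + (δ v b + cnt v (cellNames (ca ++ cb)))) ∎
  where
  open ≤-Reasoning
  regroup : ∀ a b na nb → (a + na) + (b + nb) ≡ a + (b + (na + nb))
  regroup = solve-∀

leaves-CTree : ∀ {r L C} → CTree r L C → ∀ v → cnt v L ≤ δ v r + cnt v (cellNames C)
leaves-CTree (leaf r) v = ≤-refl
leaves-CTree (wk r)   v = z≤n
leaves-CTree (node {r} {a} {b} {la} {lb} {ca} {cb} ta tb) v =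
  ≤-trans (m≤m+n _ (δ v r))
    (≤-trans (node-leaves v r a b la lb ca cb (leaves-CTree ta v) (leaves-CTree tb v)) (m≤n+m _ (δ v r)))

leaves-KTree : ∀ {r L C} → KTree r L C → ∀ v → cnt v L ≤ δ v r + cnt v (cellNames C)
leaves-KTree (leaf r) v = ≤-refl
leaves-KTree (cowk r) v = z≤n
leaves-KTree (node {r} {a} {b} {la} {lb} {ca} {cb} ta tb) v =
  ≤-trans (m≤m+n _ (δ v r))
    (≤-trans (node-leaves v r a b la lb ca cb (leaves-KTree ta v) (leaves-KTree tb v)) (m≤n+m _ (δ v r)))

wire-or-rooted-CTree : ∀ {r L C} → CTree r L C →
  (L ≡ r ∷ [] × C ≡ []) ⊎ (∀ v → cnt v L + δ v r ≤ cnt v (cellNames C))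
wire-or-rooted-CTree (leaf r) = inj₁ (refl , refl)
wire-or-rooted-CTree (wk r)   = inj₂ (λ v → ≤-reflexive (sym (+-identityʳ _)))
wire-or-rooted-CTree (node {r} {a} {b} {la} {lb} {ca} {cb} ta tb) =
  inj₂ (λ v → node-leaves v r a b la lb ca cb (leaves-CTree ta v) (leaves-CTree tb v))

wire-or-rooted-KTree : ∀ {r L C} → KTree r L C →
  (L ≡ r ∷ [] × C ≡ []) ⊎ (∀ v → cnt v L + δ v r ≤ cnt v (cellNames C))
wire-or-rooted-KTree (leaf r) = inj₁ (refl , refl)
wire-or-rooted-KTree (cowk r) = inj₂ (λ v → ≤-reflexive (sym (+-identityʳ _)))
wire-or-rooted-KTree (node {r} {a} {b} {la} {lb} {ca} {cb} ta tb) =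
  inj₂ (λ v → node-leaves v r a b la lb ca cb (leaves-KTree ta v) (leaves-KTree tb v))

Rooted : (Name → List Name → List Cell → Set) → Name → Set
Rooted Tree u = Σ (List Name) λ M → Σ (List Cell) λ D → Tree u M D

module _ {Tree : Name → List Name → List Cell → Set} where

  forestLeaves : ∀ {L} → All (Rooted Tree) L → List Name
  forestLeaves = concatAll proj₁

  forestCells : ∀ {L} → All (Rooted Tree) L → List Cell
  forestCells = concatAll λ (_ , D , _) → D

  module _ (wire : ∀ u → Tree u (u ∷ []) []) where

    bareWires : ∀ xs → All (Rooted Tree) xs
    bareWires []       = []
    bareWires (x ∷ xs) = (x ∷ [] , [] , wire x) ∷ bareWires xs

    forestLeaves-bareWires : ∀ xs → forestLeaves (bareWires xs) ≡ xs
    forestLeaves-bareWires []       = refl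
    forestLeaves-bareWires (x ∷ xs) = cong (x ∷_) (forestLeaves-bareWires xs)

    forestCells-bareWires : ∀ xs → forestCells (bareWires xs) ≡ []
    forestCells-bareWires []       = refl
    forestCells-bareWires (x ∷ xs) = forestCells-bareWires xs

  graft-cells : ∀ (c : Cell) ca cb la {lb} (ts : All (Rooted Tree) (la ++ lb)) {Ca Cb} →
    Ca ↭ ca ++ forestCells (All.++⁻ˡ la ts) → Cb ↭ cb ++ forestCells (All.++⁻ʳ la ts) →
    c ∷ Ca ++ Cb ↭ (c ∷ ca ++ cb) ++ forestCells ts
  graft-cells c ca cb la ts pa pb = prep c (↭-trans (++⁺ pa pb)
    (↭-trans (solve 4 (λ a fa b fb → (a ⊕ fa) ⊕ (b ⊕ fb) ⊜ (a ⊕ b) ⊕ (fa ⊕ fb)) ↭-refl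
                ca (forestCells (All.++⁻ˡ la ts)) cb (forestCells (All.++⁻ʳ la ts)))
             (++⁺ˡ (ca ++ cb) (↭-reflexive (sym (concatAll-++⁻ _ la ts))))))

graft-CTree : ∀ {r L C} → CTree r L C → (ts : All (Rooted CTree) L) →
  Σ (List Cell) λ C' → CTree r (forestLeaves ts) C' × C' ↭ C ++ forestCells ts
graft-CTree (leaf r) ((M , D , t) ∷ []) =
  D , subst (λ L → CTree r L D) (sym (List.++-identityʳ M)) t , ↭-reflexive (sym (List.++-identityʳ D))
graft-CTree (wk r) [] = weak r ∷ [] , wk r , ↭-refl
graft-CTree (node {r} {a} {b} {la} {lb} {ca} {cb} ta tb) ts =
  let Ca , ta' , pa = graft-CTree ta (All.++⁻ˡ la ts)
      Cb , tb' , pb = graft-CTree tb (All.++⁻ʳ la ts)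
  in contr r a b ∷ Ca ++ Cb ,
     subst (λ L → CTree r L (contr r a b ∷ Ca ++ Cb)) (sym (concatAll-++⁻ proj₁ la ts)) (node ta' tb') ,
     graft-cells (contr r a b) ca cb la ts pa pb

graft-KTree : ∀ {r L C} → KTree r L C → (ts : All (Rooted KTree) L) →
  Σ (List Cell) λ C' → KTree r (forestLeaves ts) C' × C' ↭ C ++ forestCells ts
graft-KTree (leaf r) ((M , D , t) ∷ []) =
  D , subst (λ L → KTree r L D) (sym (List.++-identityʳ M)) t , ↭-reflexive (sym (List.++-identityʳ D))
graft-KTree (cowk r) [] = coweak r ∷ [] , cowk r , ↭-refl
graft-KTree (node {r} {a} {b} {la} {lb} {ca} {cb} ta tb) ts =
  let Ca , ta' , pa = graft-KTree ta (All.++⁻ˡ la ts)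
      Cb , tb' , pb = graft-KTree tb (All.++⁻ʳ la ts)
  in cocontr r a b ∷ Ca ++ Cb ,
     subst (λ L → KTree r L (cocontr r a b ∷ Ca ++ Cb)) (sym (concatAll-++⁻ proj₁ la ts)) (node ta' tb') ,
     graft-cells (cocontr r a b) ca cb la ts pa pb

module _ (ρ : Name → Name) where

  rename-CTree : ∀ {r L C} → CTree r L C → CTree (ρ r) (map ρ L) (map (renC ρ) C)
  rename-CTree (leaf r) = leaf (ρ r)
  rename-CTree (wk r)   = wk (ρ r)
  rename-CTree (node {r} {a} {b} {la} {lb} {ca} {cb} ta tb) =
    subst₂ (λ L C → CTree (ρ r) L (contr (ρ r) (ρ a) (ρ b) ∷ C))
      (sym (List.map-++ ρ la lb)) (sym (List.map-++ (renC ρ) ca cb)) (node (rename-CTree ta) (rename-CTree tb))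

  rename-KTree : ∀ {r L C} → KTree r L C → KTree (ρ r) (map ρ L) (map (renC ρ) C)
  rename-KTree (leaf r) = leaf (ρ r)
  rename-KTree (cowk r) = cowk (ρ r)
  rename-KTree (node {r} {a} {b} {la} {lb} {ca} {cb} ta tb) =
    subst₂ (λ L C → KTree (ρ r) L (cocontr (ρ r) (ρ a) (ρ b) ∷ C))
      (sym (List.map-++ ρ la lb)) (sym (List.map-++ (renC ρ) ca cb)) (node (rename-KTree ta) (rename-KTree tb))

  cellNames-renC : ∀ cs → cellNames (map (renC ρ) cs) ≡ map ρ (cellNames cs)
  cellNames-renC []                   = refl
  cellNames-renC (contr a b c ∷ cs)   = cong (λ ns → ρ a ∷ ρ b ∷ ρ c ∷ ns) (cellNames-renC cs)
  cellNames-renC (weak a ∷ cs)        = cong (ρ a ∷_) (cellNames-renC cs)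
  cellNames-renC (cocontr a b c ∷ cs) = cong (λ ns → ρ a ∷ ρ b ∷ ρ c ∷ ns) (cellNames-renC cs)
  cellNames-renC (coweak a ∷ cs)      = cong (ρ a ∷_) (cellNames-renC cs)

-- A tree facing a cocontraction tree

reduces-weak-KTree : ∀ {r L C k} → KTree r L C → Reduces k k (weak r ∷ C) (map weak L)
reduces-weak-KTree (leaf r) = reduces-refl
reduces-weak-KTree (cowk r) = reduces-↭ (swap (weak r) (coweak r) ↭-refl) reduces-ε ↭-refl
reduces-weak-KTree (node {r} {a} {b} {la} {lb} {ca} {cb} ta tb) =
  reduces-↭ (solve 4 (λ w k A B → w ⊕ k ⊕ A ⊕ B ⊜ (k ⊕ w) ⊕ (A ⊕ B)) ↭-refl
               (weak r ∷ []) (cocontr r a b ∷ []) ca cb)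
  (reduces-trans (reduces-frameʳ (ca ++ cb) reduces-s2)
  (reduces-↭ (solve 4 (λ wa wb A B → (wa ⊕ wb) ⊕ A ⊕ B ⊜ (wa ⊕ A) ⊕ (wb ⊕ B)) ↭-refl
               (weak a ∷ []) (weak b ∷ []) ca cb)
  (reduces-trans (reduces-frameʳ (weak b ∷ cb) (reduces-weak-KTree ta))
                 (reduces-frameˡ (map weak la) (reduces-weak-KTree tb)))
  ↭-refl))
  (↭-reflexive (sym (List.map-++ weak la lb)))

Pairs : List Name → Set
Pairs = All (λ _ → Name × Name)

firsts seconds : ∀ {L} → Pairs L → List Name
firsts  = All.reduce proj₁
seconds = All.reduce proj₂

contractions : ∀ {L} → Pairs L → List Cell
contractions = All.reduce λ {l} (α , β) → contr l α β

-- The leaves α, β of the two new cocontraction trees are joined by a contraction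
-- at each leaf of the old tree.
record ContrMeetsKTree (r a b : Name) (L : List Name) (C : List Cell) (k : ℕ) : Set where
  constructor contrMeetsKTree
  field
    pairs : Pairs L
    Ca    : List Cell
    treeA : KTree a (firsts pairs) Ca
    Cb    : List Cell
    treeB : KTree b (seconds pairs) Cb
    k'    : ℕ
    k≤k'  : k ≤ k'
    steps : Reduces k k' (contr r a b ∷ C) (Ca ++ Cb ++ contractions pairs)

contr-meets-KTree : ∀ {r L C} → KTree r L C → ∀ a b k → ContrMeetsKTree r a b L C k
contr-meets-KTree (leaf r) a b k = contrMeetsKTree ((a , b) ∷ []) [] (leaf a) [] (leaf b) k ≤-refl reduces-refl
contr-meets-KTree (cowk r) a b k =
  contrMeetsKTree [] (coweak a ∷ []) (cowk a) (coweak b ∷ []) (cowk b) k ≤-refl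
    (reduces-↭ (swap (contr r a b) (coweak r) ↭-refl) reduces-s1 ↭-refl)
contr-meets-KTree (node {r} {c} {d} {lc} {ld} {cc} {cd} tc td) a b k
  with contr-meets-KTree tc (k + 0) (k + 2) (k + 4)
... | contrMeetsKTree psc C₀ t₀ C₂ t₂ k₁ k≤k₁ stepsc
  with contr-meets-KTree td (k + 1) (k + 3) k₁
... | contrMeetsKTree psd C₁ t₁ C₃ t₃ k₂ k₁≤k₂ stepsd =
  contrMeetsKTree (All.++⁺ psc psd)
    (cocontr a (k + 0) (k + 1) ∷ C₀ ++ C₁)
    (subst (λ L → KTree a L _) (sym (reduce-++⁺ proj₁ psc psd)) (node t₀ t₁))
    (cocontr b (k + 2) (k + 3) ∷ C₂ ++ C₃)
    (subst (λ L → KTree b L _) (sym (reduce-++⁺ proj₂ psc psd)) (node t₂ t₃))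
    k₂ (≤-trans (m≤m+n k 4) (≤-trans k≤k₁ k₁≤k₂))
    (reduces-trans (reduces-frameʳ (cc ++ cd) (reduces-ba k r a b c d))
    (reduces-↭ shuffle₁ (reduces-trans (reduces-frameʳ (D ++ cd ++ KA ++ KB) stepsc)
    (reduces-↭ shuffle₂ (reduces-frameʳ ((C₀ ++ C₂ ++ contractions psc) ++ KA ++ KB) stepsd) shuffle₃)) ↭-refl))
  where
  KA KB D : List Cell
  KA = cocontr a (k + 0) (k + 1) ∷ []
  KB = cocontr b (k + 2) (k + 3) ∷ []
  D  = contr d (k + 1) (k + 3) ∷ []
  shuffle₁ = solve 6 (λ ka kb c d xc xd → ka ⊕ kb ⊕ c ⊕ d ⊕ xc ⊕ xd ⊜ (c ⊕ xc) ⊕ (d ⊕ xd) ⊕ ka ⊕ kb) ↭-refl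
    KA KB (contr c (k + 0) (k + 2) ∷ []) D cc cd
  shuffle₂ = solve 7 (λ c₀ c₂ pc d xd ka kb →
      (c₀ ⊕ c₂ ⊕ pc) ⊕ (d ⊕ xd) ⊕ ka ⊕ kb ⊜ (d ⊕ xd) ⊕ (c₀ ⊕ c₂ ⊕ pc) ⊕ ka ⊕ kb) ↭-refl
    C₀ C₂ (contractions psc) D cd KA KB
  shuffle₃ = ↭-trans (solve 8 (λ c₁ c₃ pd c₀ c₂ pc ka kb →
      (c₁ ⊕ c₃ ⊕ pd) ⊕ (c₀ ⊕ c₂ ⊕ pc) ⊕ ka ⊕ kb ⊜ (ka ⊕ c₀ ⊕ c₁) ⊕ (kb ⊕ c₂ ⊕ c₃) ⊕ (pc ⊕ pd)) ↭-refl
    C₁ C₃ (contractions psd) C₀ C₂ (contractions psc) KA KB)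
    (↭-reflexive (cong (λ ps → (KA ++ C₀ ++ C₁) ++ (KB ++ C₂ ++ C₃) ++ ps)
      (sym (reduce-++⁺ (λ {l} (α , β) → contr l α β) psc psd))))

-- A column at the leaf l' of a cocontraction tree is a contraction tree rooted at l'
-- whose leaves are named g l, one for each leaf l of the facing contraction tree; the
-- row at l is a cocontraction tree rooted at l with one leaf g l per column g, so each
-- row is joined to each column by exactly one wire.
Column : List Name → Name → Set
Column L l' = Σ (Name → Name) λ g → Σ (List Cell) λ D → CTree l' (map g L) D

Row : List (Name → Name) → Name → Set
Row gs l = Σ (List Cell) λ K → KTree l (map (λ g → g l) gs) K

Columns : List Name → List Name → Set
Columns L = All (Column L)

Rows : List (Name → Name) → List Name → Set
Rows gs = All (Row gs)

namings : ∀ {L L'} → Columns L L' → List (Name → Name)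
namings = All.reduce proj₁

columnCells : ∀ {L L'} → Columns L L' → List Cell
columnCells = concatAll λ (_ , D , _) → D

rowCells : ∀ {gs L} → Rows gs L → List Cell
rowCells = concatAll proj₁

record TreesMeet (L L' : List Name) (C C' : List Cell) (k : ℕ) : Set where
  constructor treesMeet
  field
    columns : Columns L L'
    rows    : Rows (namings columns) L
    k'      : ℕ
    k≤k'    : k ≤ k'
    steps   : Reduces k k' (C ++ C') (rowCells rows ++ columnCells columns)

leafColumns : ∀ r L' → Columns (r ∷ []) L'
leafColumns r []        = []
leafColumns r (l' ∷ L') = ((λ _ → l') , [] , leaf l') ∷ leafColumns r L'

namings-leafColumns : ∀ r L' → map (λ g → g r) (namings (leafColumns r L')) ≡ L'
namings-leafColumns r []        = refl
namings-leafColumns r (l' ∷ L') = cong (l' ∷_) (namings-leafColumns r L')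

columnCells-leafColumns : ∀ r L' → columnCells (leafColumns r L') ≡ []
columnCells-leafColumns r []        = refl
columnCells-leafColumns r (l' ∷ L') = columnCells-leafColumns r L'

weakColumns : ∀ L' → Columns [] L'
weakColumns []        = []
weakColumns (l' ∷ L') = ((λ x → x) , weak l' ∷ [] , wk l') ∷ weakColumns L'

columnCells-weakColumns : ∀ L' → columnCells (weakColumns L') ≡ map weak L'
columnCells-weakColumns []        = refl
columnCells-weakColumns (l' ∷ L') = cong (weak l' ∷_) (columnCells-weakColumns L')

module JoinColumns (la lb : List Name) (disjoint : All (λ l → cnt l la ≡ 0) lb) where

  joinNaming : (Name → Name) → (Name → Name) → Name → Name
  joinNaming ga gb l = if cnt l la ≡ᵇ 0 then gb l else ga l

  joinNaming-left : ∀ ga gb l → 1 ≤ cnt l la → joinNaming ga gb l ≡ ga l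
  joinNaming-left ga gb l p with cnt l la
  ... | suc _ = refl

  joinNaming-right : ∀ ga gb l → cnt l la ≡ 0 → joinNaming ga gb l ≡ gb l
  joinNaming-right ga gb l p rewrite p = refl

  map-joinNaming : ∀ ga gb → map (joinNaming ga gb) (la ++ lb) ≡ map ga la ++ map gb lb
  map-joinNaming ga gb = trans (List.map-++ (joinNaming ga gb) la lb)
    (cong₂ _++_ (List.map-cong-local (All.map (joinNaming-left ga gb _) (occurs-self la)))
                (List.map-cong-local (All.map (joinNaming-right ga gb _) disjoint)))

  joinColumns : ∀ {L'} (ps : Pairs L') → Columns la (firsts ps) → Columns lb (seconds ps) → Columns (la ++ lb) L'
  joinColumns []                [] [] = []
  joinColumns {l' ∷ L'} ((α , β) ∷ ps) ((ga , Da , ta) ∷ as) ((gb , Db , tb) ∷ bs) =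
    (joinNaming ga gb , contr l' α β ∷ Da ++ Db ,
      subst (λ L → CTree l' L _) (sym (map-joinNaming ga gb)) (node ta tb)) ∷ joinColumns ps as bs

  namings-joinColumns-left : ∀ {L'} (ps : Pairs L') as bs l → 1 ≤ cnt l la →
    map (λ g → g l) (namings (joinColumns ps as bs)) ≡ map (λ g → g l) (namings as)
  namings-joinColumns-left []       []             []             l p = refl
  namings-joinColumns-left (_ ∷ ps) ((ga , _) ∷ as) ((gb , _) ∷ bs) l p =
    cong₂ _∷_ (joinNaming-left ga gb l p) (namings-joinColumns-left ps as bs l p)

  namings-joinColumns-right : ∀ {L'} (ps : Pairs L') as bs l → cnt l la ≡ 0 →
    map (λ g → g l) (namings (joinColumns ps as bs)) ≡ map (λ g → g l) (namings bs)
  namings-joinColumns-right []       []             []             l p = refl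
  namings-joinColumns-right (_ ∷ ps) ((ga , _) ∷ as) ((gb , _) ∷ bs) l p =
    cong₂ _∷_ (joinNaming-right ga gb l p) (namings-joinColumns-right ps as bs l p)

  columnCells-joinColumns : ∀ {L'} (ps : Pairs L') as bs →
    columnCells (joinColumns ps as bs) ↭ contractions ps ++ columnCells as ++ columnCells bs
  columnCells-joinColumns []       []             []             = ↭-refl
  columnCells-joinColumns {l' ∷ _} ((α , β) ∷ ps) ((_ , Da , _) ∷ as) ((_ , Db , _) ∷ bs) =
    ↭-trans (++⁺ˡ (contr l' α β ∷ Da ++ Db) (columnCells-joinColumns ps as bs))
      (solve 6 (λ c da db pc ca cb → (c ⊕ da ⊕ db) ⊕ pc ⊕ ca ⊕ cb ⊜ (c ⊕ pc) ⊕ (da ⊕ ca) ⊕ (db ⊕ cb)) ↭-refl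
        (contr l' α β ∷ []) Da Db (contractions ps) (columnCells as) (columnCells bs))

module _ {gs gs' : List (Name → Name)} where

  retarget : ∀ L → All (λ l → map (λ g → g l) gs ≡ map (λ g → g l) gs') L → Rows gs L → Rows gs' L
  retarget []      []       []             = []
  retarget (l ∷ L) (e ∷ es) ((K , t) ∷ rs) = (K , subst (λ L' → KTree l L' K) e t) ∷ retarget L es rs

  rowCells-retarget : ∀ L es (rs : Rows gs L) → rowCells (retarget L es rs) ≡ rowCells rs
  rowCells-retarget []      []       []             = refl
  rowCells-retarget (l ∷ L) (e ∷ es) ((K , t) ∷ rs) = cong (K ++_) (rowCells-retarget L es rs)

-- The root cell crosses the whole cocontraction tree (contr-meets-KTree); each
-- subtree then meets one of the two resulting copies, and the two families of
-- columns are glued by the contractions left at the old leaves.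
trees-meet : ∀ {r L C L' C'} → CTree r L C → KTree r L' C' → Distinct L → ∀ k → TreesMeet L L' C C' k
trees-meet {L' = L'} {C' = C'} (leaf r) t' d k =
  treesMeet (leafColumns r L') ((C' , subst (λ L → KTree r L C') (sym (namings-leafColumns r L')) t') ∷ [])
    k ≤-refl
    (reduces-↭ ↭-refl reduces-refl (↭-reflexive (sym
      (trans (cong ((C' ++ []) ++_) (columnCells-leafColumns r L'))
             (trans (List.++-identityʳ _) (List.++-identityʳ C'))))))
trees-meet {L' = L'} (wk r) t' d k =
  treesMeet (weakColumns L') [] k ≤-refl
    (reduces-↭ ↭-refl (reduces-weak-KTree t') (↭-reflexive (sym (columnCells-weakColumns L'))))
trees-meet {C' = C'} (node {r} {a} {b} {la} {lb} {ca} {cb} ta tb) t' d k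
  with contr-meets-KTree t' a b k
... | contrMeetsKTree ps Ka tka Kb tkb k₁ k≤k₁ steps₀
  with trees-meet ta tka (distinct-++ˡ la lb d) k₁
... | treesMeet colsA rowsA k₂ k₁≤k₂ stepsA
  with trees-meet tb tkb (distinct-++ʳ la lb d) k₂
... | treesMeet colsB rowsB k₃ k₂≤k₃ stepsB =
  treesMeet cols (All.++⁺ rowsA' rowsB') k₃ (≤-trans k≤k₁ (≤-trans k₁≤k₂ k₂≤k₃))
    (reduces-↭ shuffle₀ (reduces-trans (reduces-frameʳ (ca ++ cb) steps₀)
      (reduces-↭ shuffle₁ (reduces-trans (reduces-frameʳ ((cb ++ Kb) ++ contractions ps) stepsA)
        (reduces-↭ shuffle₂ (reduces-frameʳ ((rowCells rowsA ++ columnCells colsA) ++ contractions ps) stepsB)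
          shuffle₃)) ↭-refl)) ↭-refl)
  where
  open JoinColumns la lb (distinct-disjoint la lb d)
  cols = joinColumns ps colsA colsB
  eA = All.map (λ {l} p → sym (namings-joinColumns-left ps colsA colsB l p)) (occurs-self la)
  eB = All.map (λ {l} p → sym (namings-joinColumns-right ps colsA colsB l p)) (distinct-disjoint la lb d)
  rowsA' = retarget la eA rowsA
  rowsB' = retarget lb eB rowsB
  shuffle₀ = solve 4 (λ c xa xb x' → (c ⊕ xa ⊕ xb) ⊕ x' ⊜ (c ⊕ x') ⊕ (xa ⊕ xb)) ↭-refl
    (contr r a b ∷ []) ca cb C'
  shuffle₁ = solve 5 (λ ka kb pc xa xb → (ka ⊕ kb ⊕ pc) ⊕ (xa ⊕ xb) ⊜ (xa ⊕ ka) ⊕ ((xb ⊕ kb) ⊕ pc)) ↭-refl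
    Ka Kb (contractions ps) ca cb
  shuffle₂ = solve 5 (λ ra ca xb kb pc → (ra ⊕ ca) ⊕ ((xb ⊕ kb) ⊕ pc) ⊜ (xb ⊕ kb) ⊕ ((ra ⊕ ca) ⊕ pc)) ↭-refl
    (rowCells rowsA) (columnCells colsA) cb Kb (contractions ps)
  shuffle₃ = ↭-trans (solve 5 (λ rb cb ra ca pc → (rb ⊕ cb) ⊕ ((ra ⊕ ca) ⊕ pc) ⊜ (ra ⊕ rb) ⊕ (pc ⊕ ca ⊕ cb)) ↭-refl
      (rowCells rowsB) (columnCells colsB) (rowCells rowsA) (columnCells colsA) (contractions ps))
    (++⁺ (↭-reflexive (trans (cong₂ _++_ (sym (rowCells-retarget la eA rowsA)) (sym (rowCells-retarget lb eB rowsB)))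
                             (sym (concatAll-++⁺ proj₁ rowsA' rowsB'))))
         (↭-sym (columnCells-joinColumns ps colsA colsB)))

-- Routing areas

+-exchange : ∀ a b c d → (a + b) + (c + d) ≡ (a + c) + (b + d)
+-exchange = solve-∀

leaves-forest : ∀ {A : Set} (root : A → Name) (Ls : A → List Name) (Cs : A → List Cell) →
  (∀ x v → cnt v (Ls x) ≤ δ v (root x) + cnt v (cellNames (Cs x))) →
  ∀ v xs → cnt v (concatMap Ls xs) ≤ cnt v (map root xs) + cnt v (cellNames (concatMap Cs xs))
leaves-forest root Ls Cs h v []       = z≤n
leaves-forest root Ls Cs h v (x ∷ xs) = begin
  cnt v (Ls x ++ concatMap Ls xs)
    ≡⟨ cnt-++ v (Ls x) _ ⟩
  cnt v (Ls x) + cnt v (concatMap Ls xs)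
    ≤⟨ +-mono-≤ (h x v) (leaves-forest root Ls Cs h v xs) ⟩
  (δ v (root x) + cnt v (cellNames (Cs x))) + (cnt v (map root xs) + cnt v (cellNames (concatMap Cs xs)))
    ≡⟨ +-exchange (δ v (root x)) _ _ _ ⟩
  (δ v (root x) + cnt v (map root xs)) + (cnt v (cellNames (Cs x)) + cnt v (cellNames (concatMap Cs xs)))
    ≡⟨ cong (_ +_) (sym (cnt-cellNames-++ v (Cs x) _)) ⟩
  cnt v (map root (x ∷ xs)) + cnt v (cellNames (concatMap Cs (x ∷ xs))) ∎
  where open ≤-Reasoning

module RoutingArea {m n} {R : Fin m → Fin n → ℕ} {N : Net m n} (IR : IsRouting R N) where
  open IsRouting IR

  wires : List Name
  wires = concatMap (λ x → concatMap (W x) (allFin n)) (allFin m)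

  wires-↭-inputLeaves : wires ↭ concatMap inL (allFin m)
  wires-↭-inputLeaves = concatMap-cong-↭ (allFin m) (λ x → ↭-sym (inL-W x))

  wires-↭-outputLeaves : wires ↭ concatMap outL (allFin n)
  wires-↭-outputLeaves = ↭-trans (concatMap-comm-↭ W (allFin m) (allFin n))
    (concatMap-cong-↭ (allFin n) (λ y → ↭-sym (outL-W y)))

  inSide outSide : Name → ℕ
  inSide  v = cnt v (map (ins N) (allFin m)) + cnt v (cellNames (concatMap inT (allFin m)))
  outSide v = cnt v (map (outs N) (allFin n)) + cnt v (cellNames (concatMap outT (allFin n)))

  occ-sides : ∀ v → occ v N ≡ inSide v + outSide v
  occ-sides v = begin
    occ v N
      ≡⟨ cnt-++ v (cellNames (cells N)) _ ⟩
    cnt v (cellNames (cells N)) + cnt v (map (ins N) (allFin m) ++ map (outs N) (allFin n))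
      ≡⟨ cong₂ _+_ (trans (cnt-↭ v (concatMap-↭ namesC cells-T))
                          (cnt-cellNames-++ v (concatMap inT (allFin m)) (concatMap outT (allFin n))))
                   (cnt-++ v (map (ins N) (allFin m)) (map (outs N) (allFin n))) ⟩
    (cnt v (cellNames (concatMap inT (allFin m))) + cnt v (cellNames (concatMap outT (allFin n))))
      + (cnt v (map (ins N) (allFin m)) + cnt v (map (outs N) (allFin n)))
      ≡⟨ trans (+-comm (cnt v (cellNames (concatMap inT (allFin m))) + _) _)
               (+-exchange (cnt v (map (ins N) (allFin m))) _ _ _) ⟩
    inSide v + outSide v ∎
    where open ≡-Reasoning

  occ≤2 : ∀ v → occ v N ≤ 2
  occ≤2 v = ZeroOrTwo⇒≤2 (wf v)

  -- Each wire is a leaf of an input tree and of an output tree, and these are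
  -- disjoint occurrences of its name, of which there are at most two.
  wires-distinct : Distinct wires
  wires-distinct v = half-≤1 (cnt v wires) (begin
    cnt v wires + cnt v wires
      ≡⟨ cong₂ _+_ (cnt-↭ v wires-↭-inputLeaves) (cnt-↭ v wires-↭-outputLeaves) ⟩
    cnt v (concatMap inL (allFin m)) + cnt v (concatMap outL (allFin n))
      ≤⟨ +-mono-≤ (leaves-forest (ins N) inL inT (λ x → leaves-CTree (inTree x)) v (allFin m))
                  (leaves-forest (outs N) outL outT (λ y → leaves-KTree (outTree y)) v (allFin n)) ⟩
    inSide v + outSide v
      ≡⟨ sym (occ-sides v) ⟩
    occ v N
      ≤⟨ occ≤2 v ⟩
    2 ∎)
    where open ≤-Reasoning

  occ-≥-trees : ∀ v x y →
    (δ v (ins N x) + cnt v (cellNames (inT x))) + (δ v (outs N y) + cnt v (cellNames (outT y))) ≤ occ v N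
  occ-≥-trees v x y = subst (_ ≤_) (sym (occ-sides v))
    (+-mono-≤ (+-mono-≤ (δ-≤-cnt-map (ins N) x v) (cnt-cells-≤ inT x v))
              (+-mono-≤ (δ-≤-cnt-map (outs N) y v) (cnt-cells-≤ outT y v)))

module Identify (ri ro : Name) (ri≢ro : ri ≢ ro) where

  ρ : Name → Name
  ρ = ro ↦ₙ ri

  ρ-cases : ∀ x → (x ≡ ro × ρ x ≡ ri) ⊎ (x ≢ ro × ρ x ≡ x)
  ρ-cases x with ≡ᵇ-cases x ro
  ... | inj₁ (x≡ro , p) = inj₁ (x≡ro , cong (λ b → if b then ri else x) p)
  ... | inj₂ (x≢ro , p) = inj₂ (x≢ro , cong (λ b → if b then ri else x) p)

  ρ-ro : ρ ro ≡ ri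
  ρ-ro with ρ-cases ro
  ... | inj₁ (_ , p)   = p
  ... | inj₂ (ro≢ro , _) = ⊥-elim (ro≢ro refl)

  ρ-ri : ρ ri ≡ ri
  ρ-ri with ρ-cases ri
  ... | inj₁ (_ , p) = p
  ... | inj₂ (_ , p) = p

  cnt-map-ρ-ri : ∀ xs → cnt ri (map ρ xs) ≡ cnt ri xs + cnt ro xs
  cnt-map-ρ-ri []       = refl
  cnt-map-ρ-ri (x ∷ xs) with ρ-cases x
  ... | inj₁ (refl , p) rewrite p | δ-refl ri | δ-refl ro | δ-≢ ri≢ro | cnt-map-ρ-ri xs = sym (+-suc _ _)
  ... | inj₂ (x≢ro , p) rewrite p | δ-≢ {ro} {x} (x≢ro ∘ sym) | cnt-map-ρ-ri xs = sym (+-assoc (δ ri x) _ _)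

  cnt-map-ρ-ro : ∀ xs → cnt ro (map ρ xs) ≡ 0
  cnt-map-ρ-ro []       = refl
  cnt-map-ρ-ro (x ∷ xs) with ρ-cases x
  ... | inj₁ (refl , p) rewrite p | δ-≢ {ro} {ri} (ri≢ro ∘ sym) | cnt-map-ρ-ro xs = refl
  ... | inj₂ (x≢ro , p) rewrite p | δ-≢ {ro} {x} (x≢ro ∘ sym) | cnt-map-ρ-ro xs = refl

  cnt-map-ρ-other : ∀ v → v ≢ ri → v ≢ ro → ∀ xs → cnt v (map ρ xs) ≡ cnt v xs
  cnt-map-ρ-other v v≢ri v≢ro []       = refl
  cnt-map-ρ-other v v≢ri v≢ro (x ∷ xs) with ρ-cases x
  ... | inj₁ (refl , p) rewrite p | δ-≢ v≢ri | δ-≢ v≢ro | cnt-map-ρ-other v v≢ri v≢ro xs = refl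
  ... | inj₂ (_ , p)    rewrite p | cnt-map-ρ-other v v≢ri v≢ro xs = refl

length≡0⇒[] : ∀ {A : Set} (xs : List A) → length xs ≡ 0 → xs ≡ []
length≡0⇒[] [] _ = refl

both-zero : ∀ a b → (1 + a) + (1 + b) ≤ 2 → a ≡ 0 × b ≡ 0
both-zero zero    zero    _ = refl , refl
both-zero zero    (suc b) (s≤s (s≤s ()))
both-zero (suc a) b       (s≤s (s≤s p)) with ≤-trans (m≤n+m (suc b) a) p
... | ()

module Connection {m n} (R : Fin (suc m) → Fin (suc n) → ℕ) (i : Fin (suc m)) (o : Fin (suc n))
  (Rio≡0 : R i o ≡ 0) (cs : List Cell) (ι : Fin (suc m) → Name) (ω : Fin (suc n) → Name) (l : ℕ)
  (IR : IsRouting R (net cs ι ω l)) where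

  open IsRouting IR
  open RoutingArea IR

  N : Net (suc m) (suc n)
  N = net cs ι ω l

  ri ro : Name
  ri = ι i
  ro = ω o

  W-io : W i o ≡ []
  W-io = length≡0⇒[] (W i o) (trans (W-len i o) Rio≡0)

  otherWires : List Name
  otherWires = concatMap (λ x' → concatMap (W (punchIn i x')) (allFin (suc n))) (allFin m)

  cnt-wires : ∀ v → cnt v wires ≡ cnt v (concatMap (W i) (allFin (suc n))) + cnt v otherWires
  cnt-wires v = trans (cnt-↭ v (concatMap-allFin-punchIn (λ x → concatMap (W x) (allFin (suc n))) i))
                      (cnt-++ v (concatMap (W i) (allFin (suc n))) _)

  -- If ι i = ω o, that name has its two occurrences at the free ports, so both
  -- trees are bare wires: the name is then a wire of i and a wire of o, two
  -- different wires since R i o = 0, against wires-distinct.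
  ri≢ro : ri ≢ ro
  ri≢ro ri≡ro = 1+n≰n (begin
    2
      ≡⟨ cong₂ _+_ (sym (wires-of-i)) (sym (wires-of-o)) ⟩
    cnt v (concatMap (W i) (allFin (suc n))) + cnt v (concatMap (λ x' → W (punchIn i x') o) (allFin m))
      ≤⟨ +-monoʳ-≤ _ (cnt-mono-concatMap (allFin m)
           (λ x' → subst (cnt v (W (punchIn i x') o) ≤_) (sym (cnt-↭ v (concatMap-allFin-punchIn (W (punchIn i x')) o)))
                    (cnt-≤-++ˡ v (W (punchIn i x') o) _))) ⟩
    cnt v (concatMap (W i) (allFin (suc n))) + cnt v otherWires
      ≡⟨ sym (cnt-wires v) ⟩
    cnt v wires
      ≤⟨ wires-distinct v ⟩
    1 ∎)
    where
    open ≤-Reasoning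
    v = ri
    δ-in : δ v ri ≡ 1
    δ-in = δ-refl v
    δ-out : δ v ro ≡ 1
    δ-out = trans (cong (δ v) (sym ri≡ro)) (δ-refl v)
    no-cells : cnt v (cellNames (inT i)) ≡ 0 × cnt v (cellNames (outT o)) ≡ 0
    no-cells = both-zero _ _ (≤-trans
      (≤-reflexive (cong₂ (λ a b → (a + cnt v (cellNames (inT i))) + (b + cnt v (cellNames (outT o))))
                          (sym δ-in) (sym δ-out)))
                                      (≤-trans (occ-≥-trees v i o) (occ≤2 v)))
    bare-in : inL i ≡ ri ∷ []
    bare-in with wire-or-rooted-CTree (inTree i)
    ... | inj₁ (eq , _) = eq
    ... | inj₂ rooted = ⊥-elim (1+n≰n (≤-trans
      (≤-trans (subst (1 ≤_) (sym (cong (cnt v (inL i) +_) δ-in)) (m≤n+m 1 _)) (rooted v))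
      (≤-reflexive (proj₁ no-cells))))
    bare-out : outL o ≡ ro ∷ []
    bare-out with wire-or-rooted-KTree (outTree o)
    ... | inj₁ (eq , _) = eq
    ... | inj₂ rooted = ⊥-elim (1+n≰n (≤-trans
      (≤-trans (subst (1 ≤_) (sym (cong (cnt v (outL o) +_) δ-out)) (m≤n+m 1 _)) (rooted v))
      (≤-reflexive (proj₂ no-cells))))
    wires-of-i : cnt v (concatMap (W i) (allFin (suc n))) ≡ 1
    wires-of-i = trans (sym (cnt-↭ v (inL-W i))) (trans (cong (cnt v) bare-in) (cong (_+ 0) δ-in))
    wires-of-o : cnt v (concatMap (λ x' → W (punchIn i x') o) (allFin m)) ≡ 1
    wires-of-o = trans (sym (trans (cnt-↭ v (concatMap-allFin-punchIn (λ x → W x o) i))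
                                   (cong (λ ws → cnt v (ws ++ concatMap (λ x' → W (punchIn i x') o) (allFin m))) W-io)))
                       (trans (sym (cnt-↭ v (outL-W o))) (trans (cong (cnt v) bare-out) (cong (_+ 0) δ-out)))

  open Identify ri ro ri≢ro public

  inputLeaves-distinct : Distinct (inL i)
  inputLeaves-distinct v = ≤-trans (≤-reflexive (cnt-↭ v (inL-W i)))
    (≤-trans (m≤m+n _ _) (≤-trans (≤-reflexive (sym (cnt-wires v))) (wires-distinct v)))

  Li : List Name
  Li = map ρ (inL i)

  -- Only ri can collide after renaming; it is no leaf of i unless i's tree is a bare wire.
  Li-distinct : Distinct Li
  Li-distinct v with δ-cases v ri | δ-cases v ro
  ... | inj₁ (refl , _) | _ = subst (_≤ 1) (sym (cnt-map-ρ-ri (inL i))) ri-and-ro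
    where
    ri-and-ro : cnt ri (inL i) + cnt ro (inL i) ≤ 1
    ri-and-ro with wire-or-rooted-CTree (inTree i)
    ... | inj₁ (bare , _) rewrite bare | δ-refl ri | δ-≢ {ro} {ri} (ri≢ro ∘ sym) = ≤-refl
    ... | inj₂ rooted = subst (λ c → c + cnt ro (inL i) ≤ 1) (sym ri-no-leaf) (inputLeaves-distinct ro)
      where
      bound : 1 + (cnt ri (inL i) + 1) ≤ 2
      bound = subst (λ d → d + (cnt ri (inL i) + d) ≤ 2) (δ-refl ri)
        (≤-trans (+-monoʳ-≤ (δ ri ri) (rooted ri))
        (≤-trans (m≤m+n _ _) (≤-trans (occ-≥-trees ri i o) (occ≤2 ri))))
      ri-no-leaf : cnt ri (inL i) ≡ 0
      ri-no-leaf = n≤0⇒n≡0 (+-cancelʳ-≤ 1 _ 0 (s≤s⁻¹ bound))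
  ... | inj₂ (_ , _)    | inj₁ (refl , _) = subst (_≤ 1) (sym (cnt-map-ρ-ro (inL i))) z≤n
  ... | inj₂ (v≢ri , _) | inj₂ (v≢ro , _) =
    subst (_≤ 1) (sym (cnt-map-ρ-other v v≢ri v≢ro (inL i))) (inputLeaves-distinct v)

  ι₁ : Fin m → Name
  ι₁ x' = ρ (ι (punchIn i x'))

  ω₁ : Fin n → Name
  ω₁ y' = ρ (ω (punchIn o y'))

  N₁ : Net m n
  N₁ = net (map (renC ρ) cs) ι₁ ω₁ l

  connect-≡ : connect N i o ≡ N₁
  connect-≡ with ≡ᵇ-cases ri ro
  ... | inj₁ (ri≡ro , _) = ⊥-elim (ri≢ro ri≡ro)
  ... | inj₂ (_ , p) rewrite p = refl

  otherNames : List Name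
  otherNames = cellNames cs ++ map (ι ∘ punchIn i) (allFin m) ++ map (ω ∘ punchIn o) (allFin n)

  netNames-N₁ : netNames N₁ ≡ map ρ otherNames
  netNames-N₁ = trans
    (cong₂ _++_ (cellNames-renC ρ cs)
      (cong₂ _++_ (List.map-∘ {g = ρ} {f = ι ∘ punchIn i} (allFin m))
                  (List.map-∘ {g = ρ} {f = ω ∘ punchIn o} (allFin n))))
    (sym (trans (List.map-++ ρ (cellNames cs) _)
      (cong (map ρ (cellNames cs) ++_)
        (List.map-++ ρ (map (ι ∘ punchIn i) (allFin m)) (map (ω ∘ punchIn o) (allFin n))))))

  occ-N : ∀ v → occ v N ≡ δ v ri + δ v ro + cnt v otherNames
  occ-N v = begin
    occ v N
      ≡⟨ cnt-↭ v (++⁺ˡ (cellNames cs) (++⁺ (map-allFin-punchIn ι i) (map-allFin-punchIn ω o))) ⟩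
    cnt v (cellNames cs ++ (ri ∷ is) ++ (ro ∷ os))
      ≡⟨ trans (cnt-++ v (cellNames cs) _) (cong (cnt v (cellNames cs) +_) (cnt-++ v (ri ∷ is) _)) ⟩
    cnt v (cellNames cs) + ((δ v ri + cnt v is) + (δ v ro + cnt v os))
      ≡⟨ regroup (cnt v (cellNames cs)) (δ v ri) (cnt v is) (δ v ro) (cnt v os) ⟩
    δ v ri + δ v ro + (cnt v (cellNames cs) + (cnt v is + cnt v os))
      ≡⟨ cong (δ v ri + δ v ro +_)
           (sym (trans (cnt-++ v (cellNames cs) _) (cong (cnt v (cellNames cs) +_) (cnt-++ v is _)))) ⟩
    δ v ri + δ v ro + cnt v otherNames ∎
    where
    open ≡-Reasoning
    is = map (ι ∘ punchIn i) (allFin m)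
    os = map (ω ∘ punchIn o) (allFin n)
    regroup : ∀ a b c d e → a + ((b + c) + (d + e)) ≡ b + d + (a + (c + e))
    regroup = solve-∀

  -- The two free ends ri and ro become one wire; all other names keep their count.
  WF-N₁ : WF N₁
  WF-N₁ v = subst (λ ns → ZeroOrTwo (cnt v ns)) (sym netNames-N₁) (renamed v)
    where
    once : ∀ u → δ u ri + δ u ro ≡ 1 → cnt u otherNames ≡ 1
    once u eq with wf u | occ-N u
    ... | inj₁ none | eq' =
      ⊥-elim (1+n≰n (subst (1 ≤_) (trans (sym eq') none) (≤-trans (≤-reflexive (sym eq)) (m≤m+n _ _))))
    ... | inj₂ two  | eq' = suc-injective (trans (cong (_+ cnt u otherNames) (sym eq)) (trans (sym eq') two))
    renamed : ∀ v → ZeroOrTwo (cnt v (map ρ otherNames))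
    renamed v with δ-cases v ri | δ-cases v ro
    ... | inj₁ (refl , _) | _ = inj₂ (trans (cnt-map-ρ-ri otherNames)
      (cong₂ _+_ (once ri (cong₂ _+_ (δ-refl ri) (δ-≢ ri≢ro)))
                 (once ro (cong₂ _+_ (δ-≢ (ri≢ro ∘ sym)) (δ-refl ro)))))
    ... | inj₂ _ | inj₁ (refl , _) = inj₁ (cnt-map-ρ-ro otherNames)
    ... | inj₂ (v≢ri , δ₁) | inj₂ (v≢ro , δ₂) = subst ZeroOrTwo
      (trans (occ-N v) (trans (cong (_+ cnt v otherNames) (cong₂ _+_ δ₁ δ₂))
                              (sym (cnt-map-ρ-other v v≢ri v≢ro otherNames))))
      (wf v)

  k₀ : ℕ
  k₀ = suc (foldr _⊔_ 0 (netNames N₁))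

  Lo : List Name
  Lo = map ρ (outL o)

  Ci Co : List Cell
  Ci = map (renC ρ) (inT i)
  Co = map (renC ρ) (outT o)

  Ti : CTree ri Li Ci
  Ti = subst (λ r → CTree r Li Ci) ρ-ri (rename-CTree ρ (inTree i))

  Ko : KTree ri Lo Co
  Ko = subst (λ r → KTree r Lo Co) ρ-ro (rename-KTree ρ (outTree o))

  meet : TreesMeet Li Lo Ci Co k₀
  meet = trees-meet Ti Ko Li-distinct k₀

  open TreesMeet meet

  gs : List (Name → Name)
  gs = namings columns

  otherInCells otherOutCells : List Cell
  otherInCells  = concatMap (λ x' → map (renC ρ) (inT (punchIn i x'))) (allFin m)
  otherOutCells = concatMap (λ y' → map (renC ρ) (outT (punchIn o y'))) (allFin n)

  cells-N₁-↭ : map (renC ρ) cs ↭ (Ci ++ Co) ++ otherInCells ++ otherOutCells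
  cells-N₁-↭ = ↭-trans (map⁺ (renC ρ) cells-T)
    (↭-trans (↭-reflexive (trans (List.map-++ (renC ρ) (concatMap inT (allFin (suc m))) _)
               (cong₂ _++_ (List.map-concatMap (renC ρ) inT (allFin (suc m)))
                           (List.map-concatMap (renC ρ) outT (allFin (suc n))))))
    (↭-trans (++⁺ (concatMap-allFin-punchIn (map (renC ρ) ∘ inT) i)
                  (concatMap-allFin-punchIn (map (renC ρ) ∘ outT) o))
      (solve 4 (λ ci xi co xo → (ci ⊕ xi) ⊕ (co ⊕ xo) ⊜ (ci ⊕ co) ⊕ xi ⊕ xo) ↭-refl
        Ci otherInCells Co otherOutCells)))

  toO : Fin m → List Name
  toO x' = map ρ (W (punchIn i x') o)

  fromI : Fin n → List Name
  fromI y' = map ρ (W i (punchIn o y'))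

  renamed-leaves-↭ : ∀ {k} (Ws : Fin (suc k) → List Name) (j : Fin (suc k)) → Ws j ≡ [] →
    map ρ (concatMap Ws (allFin (suc k))) ↭ concatMap (map ρ ∘ Ws ∘ punchIn j) (allFin k)
  renamed-leaves-↭ {k} Ws j empty = ↭-trans (↭-reflexive (List.map-concatMap ρ Ws (allFin (suc k))))
    (↭-trans (concatMap-allFin-punchIn (map ρ ∘ Ws) j)
      (↭-reflexive (cong (λ ws → map ρ ws ++ concatMap (map ρ ∘ Ws ∘ punchIn j) (allFin k)) empty)))

  Lo-↭ : Lo ↭ concatMap toO (allFin m)
  Lo-↭ = ↭-trans (map⁺ ρ (outL-W o)) (renamed-leaves-↭ (λ x → W x o) i W-io)

  Li-↭ : Li ↭ concatMap fromI (allFin n)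
  Li-↭ = ↭-trans (map⁺ ρ (inL-W i)) (renamed-leaves-↭ (W i) o W-io)

  columnsAt : (x' : Fin m) → Columns Li (toO x')
  columnsAt = restrictAll {P = Column Li} toO (All-resp-↭ Lo-↭ columns)

  rowsAt : (y' : Fin n) → Rows gs (fromI y')
  rowsAt = restrictAll {P = Row gs} fromI (All-resp-↭ Li-↭ rows)

  keptIn : Fin m → List Name
  keptIn x' = concatMap (λ y' → map ρ (W (punchIn i x') (punchIn o y'))) (allFin n)

  keptOut : Fin n → List Name
  keptOut y' = concatMap (λ x' → map ρ (W (punchIn i x') (punchIn o y'))) (allFin m)

  inLeaves-↭ : ∀ x' → map ρ (inL (punchIn i x')) ↭ toO x' ++ keptIn x'
  inLeaves-↭ x' = ↭-trans (map⁺ ρ (inL-W (punchIn i x')))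
    (↭-trans (↭-reflexive (List.map-concatMap ρ (W (punchIn i x')) (allFin (suc n))))
             (concatMap-allFin-punchIn (map ρ ∘ W (punchIn i x')) o))

  outLeaves-↭ : ∀ y' → map ρ (outL (punchIn o y')) ↭ fromI y' ++ keptOut y'
  outLeaves-↭ y' = ↭-trans (map⁺ ρ (outL-W (punchIn o y')))
    (↭-trans (↭-reflexive (List.map-concatMap ρ (λ x → W x (punchIn o y')) (allFin (suc m))))
             (concatMap-allFin-punchIn (λ x → map ρ (W x (punchIn o y'))) i))

  columnTree : ∀ {u} → Column Li u → Rooted CTree u
  columnTree (g , D , t) = map g Li , D , t

  rowTree : ∀ {u} → Row gs u → Rooted KTree u
  rowTree {u} (K , t) = map (λ g → g u) gs , K , t

  -- The new tree of input x' grafts the columns at its leaves that faced o.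
  inForest : ∀ x' → All (Rooted CTree) (map ρ (inL (punchIn i x')))
  inForest x' = All-resp-↭ (↭-sym (inLeaves-↭ x'))
    (All.++⁺ (All.map columnTree (columnsAt x')) (bareWires leaf (keptIn x')))

  outForest : ∀ y' → All (Rooted KTree) (map ρ (outL (punchIn o y')))
  outForest y' = All-resp-↭ (↭-sym (outLeaves-↭ y'))
    (All.++⁺ (All.map rowTree (rowsAt y')) (bareWires leaf (keptOut y')))

  newIn : ∀ x' → Σ (List Cell) λ C → CTree (ι₁ x') (forestLeaves (inForest x')) C
                   × C ↭ map (renC ρ) (inT (punchIn i x')) ++ forestCells (inForest x')
  newIn x' = graft-CTree (rename-CTree ρ (inTree (punchIn i x'))) (inForest x')

  newOut : ∀ y' → Σ (List Cell) λ C → KTree (ω₁ y') (forestLeaves (outForest y')) C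
                    × C ↭ map (renC ρ) (outT (punchIn o y')) ++ forestCells (outForest y')
  newOut y' = graft-KTree (rename-KTree ρ (outTree (punchIn o y'))) (outForest y')

  namingsAt : Fin m → List (Name → Name)
  namingsAt x' = namings (columnsAt x')

  -- Each column at x' carries one new wire to every row, i.e. to every wire of i.
  W' : Fin m → Fin n → List Name
  W' x' y' = map ρ (W (punchIn i x') (punchIn o y')) ++ concatMap (λ g → map g (fromI y')) (namingsAt x')

  length-W' : ∀ x' y' → length (W' x' y') ≡ Tof R i o x' y'
  length-W' x' y' = trans (List.length-++ (map ρ (W (punchIn i x') (punchIn o y'))))
    (cong₂ _+_ (length-renamed x (y))
      (trans (length-concatMap (λ g → map g (fromI y')) (namingsAt x') (λ g → List.length-map g (fromI y')))
        (cong₂ _*_ (trans (length-reduce proj₁ (columnsAt x')) (length-renamed x o)) (length-renamed i y))))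
    where
    x = punchIn i x'
    y = punchIn o y'
    length-renamed : ∀ x y → length (map ρ (W x y)) ≡ R x y
    length-renamed x y = trans (List.length-map ρ (W x y)) (W-len x y)

  newInLeaves : Fin m → List Name
  newInLeaves x' = forestLeaves (inForest x')

  newOutLeaves : Fin n → List Name
  newOutLeaves y' = forestLeaves (outForest y')

  newInLeaves-↭ : ∀ x' → newInLeaves x' ↭ concatMap (λ g → map g Li) (namingsAt x') ++ keptIn x'
  newInLeaves-↭ x' = ↭-trans (concatAll-resp-↭ proj₁ (↭-sym (inLeaves-↭ x')) forest)
    (↭-reflexive (trans (concatAll-++⁺ proj₁ (All.map columnTree (columnsAt x')) (bareWires leaf (keptIn x')))
      (cong₂ _++_ (trans (concatAll-map proj₁ columnTree (columnsAt x'))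
                         (concatAll-reduce (λ g → map g Li) proj₁ (columnsAt x')))
                  (forestLeaves-bareWires leaf (keptIn x')))))
    where forest = All.++⁺ (All.map columnTree (columnsAt x')) (bareWires leaf (keptIn x'))

  newOutLeaves-↭ : ∀ y' → newOutLeaves y' ↭ concatMap (λ u → map (λ g → g u) gs) (fromI y') ++ keptOut y'
  newOutLeaves-↭ y' = ↭-trans (concatAll-resp-↭ proj₁ (↭-sym (outLeaves-↭ y')) forest)
    (↭-reflexive (trans (concatAll-++⁺ proj₁ (All.map rowTree (rowsAt y')) (bareWires leaf (keptOut y')))
      (cong₂ _++_ (trans (concatAll-map proj₁ rowTree (rowsAt y')) (rowLeaves (rowsAt y')))
                  (forestLeaves-bareWires leaf (keptOut y')))))
    where
    forest = All.++⁺ (All.map rowTree (rowsAt y')) (bareWires leaf (keptOut y'))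
    rowLeaves : ∀ {L} (rs : Rows gs L) → concatAll (proj₁ ∘ rowTree) rs ≡ concatMap (λ u → map (λ g → g u) gs) L
    rowLeaves []                = refl
    rowLeaves {u ∷ _} (_ ∷ rs) = cong (map (λ g → g u) gs ++_) (rowLeaves rs)

  namingsAt-↭ : concatMap namingsAt (allFin m) ↭ gs
  namingsAt-↭ = ↭-trans (↭-reflexive (trans
      (List.concatMap-cong (λ x' → reduce-as-concatAll proj₁ (columnsAt x')) (allFin m))
      (sym (concatAll-restrictAll single toO (All-resp-↭ Lo-↭ columns)))))
    (↭-trans (concatAll-resp-↭ single Lo-↭ columns) (↭-reflexive (sym (reduce-as-concatAll proj₁ columns))))
    where
    single : ∀ {u} → Column Li u → List (Name → Name)
    single c = proj₁ c ∷ []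

  inL-W' : ∀ x' → newInLeaves x' ↭ concatMap (W' x') (allFin n)
  inL-W' x' = ↭-trans (newInLeaves-↭ x')
    (↭-trans (++⁺ʳ (keptIn x')
      (↭-trans (concatMap-cong-↭ (namingsAt x')
                 (λ g → ↭-trans (map⁺ g Li-↭) (↭-reflexive (List.map-concatMap g fromI (allFin n)))))
               (concatMap-comm-↭ (λ g y' → map g (fromI y')) (namingsAt x') (allFin n))))
    (↭-trans (++-comm _ (keptIn x'))
      (↭-sym (concatMap-++-↭ (λ y' → map ρ (W (punchIn i x') (punchIn o y')))
                             (λ y' → concatMap (λ g → map g (fromI y')) (namingsAt x')) (allFin n)))))

  outL-W' : ∀ y' → newOutLeaves y' ↭ concatMap (λ x' → W' x' y') (allFin m)
  outL-W' y' = ↭-trans (newOutLeaves-↭ y')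
    (↭-trans (++⁺ʳ (keptOut y') rowsToColumns)
    (↭-trans (++-comm _ (keptOut y'))
      (↭-sym (concatMap-++-↭ (λ x' → map ρ (W (punchIn i x') (punchIn o y')))
                             (λ x' → concatMap (λ g → map g (fromI y')) (namingsAt x')) (allFin m)))))
    where
    rowsToColumns : concatMap (λ u → map (λ g → g u) gs) (fromI y')
                  ↭ concatMap (λ x' → concatMap (λ g → map g (fromI y')) (namingsAt x')) (allFin m)
    rowsToColumns =
      ↭-trans (concatMap-cong-↭ (fromI y') (λ u → ↭-reflexive (map-as-concatMap (λ g → g u) gs)))
      (↭-trans (concatMap-comm-↭ (λ u g → g u ∷ []) (fromI y') gs)
      (↭-trans (concatMap-cong-↭ gs (λ g → ↭-reflexive (sym (map-as-concatMap g (fromI y')))))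
      (↭-trans (concatMap-↭ (λ g → map g (fromI y')) (↭-sym namingsAt-↭))
               (↭-reflexive (concatMap-concatMap (λ g → map g (fromI y')) namingsAt (allFin m))))))

  newInCells : Fin m → List Cell
  newInCells x' = proj₁ (newIn x')

  newOutCells : Fin n → List Cell
  newOutCells y' = proj₁ (newOut y')

  newInCells-↭ : ∀ x' → newInCells x' ↭ map (renC ρ) (inT (punchIn i x')) ++ columnCells (columnsAt x')
  newInCells-↭ x' = ↭-trans (proj₂ (proj₂ (newIn x'))) (++⁺ˡ (map (renC ρ) (inT (punchIn i x')))
    (↭-trans (concatAll-resp-↭ cellsOf (↭-sym (inLeaves-↭ x')) forest)
      (↭-reflexive (trans (concatAll-++⁺ cellsOf (All.map columnTree (columnsAt x')) (bareWires leaf (keptIn x')))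
        (trans (cong₂ _++_ (concatAll-map cellsOf columnTree (columnsAt x')) (forestCells-bareWires leaf (keptIn x')))
               (List.++-identityʳ _))))))
    where
    forest = All.++⁺ (All.map columnTree (columnsAt x')) (bareWires leaf (keptIn x'))
    cellsOf : ∀ {u} → Rooted CTree u → List Cell
    cellsOf (_ , D , _) = D

  newOutCells-↭ : ∀ y' → newOutCells y' ↭ map (renC ρ) (outT (punchIn o y')) ++ rowCells (rowsAt y')
  newOutCells-↭ y' = ↭-trans (proj₂ (proj₂ (newOut y'))) (++⁺ˡ (map (renC ρ) (outT (punchIn o y')))
    (↭-trans (concatAll-resp-↭ cellsOf (↭-sym (outLeaves-↭ y')) forest)
      (↭-reflexive (trans (concatAll-++⁺ cellsOf (All.map rowTree (rowsAt y')) (bareWires leaf (keptOut y')))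
        (trans (cong₂ _++_ (concatAll-map cellsOf rowTree (rowsAt y')) (forestCells-bareWires leaf (keptOut y')))
               (List.++-identityʳ _))))))
    where
    forest = All.++⁺ (All.map rowTree (rowsAt y')) (bareWires leaf (keptOut y'))
    cellsOf : ∀ {u} → Rooted KTree u → List Cell
    cellsOf (_ , D , _) = D

  newCells : List Cell
  newCells = concatMap newInCells (allFin m) ++ concatMap newOutCells (allFin n)

  newCells-↭ : (rowCells rows ++ columnCells columns) ++ otherInCells ++ otherOutCells ↭ newCells
  newCells-↭ = ↭-sym (↭-trans (++⁺ ins-↭ outs-↭)
    (solve 4 (λ xi cc xo rc → (xi ⊕ cc) ⊕ (xo ⊕ rc) ⊜ (rc ⊕ cc) ⊕ xi ⊕ xo) ↭-refl
      otherInCells (columnCells columns) otherOutCells (rowCells rows)))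
    where
    ins-↭ : concatMap newInCells (allFin m) ↭ otherInCells ++ columnCells columns
    ins-↭ = ↭-trans (concatMap-cong-↭ (allFin m) newInCells-↭)
      (↭-trans (concatMap-++-↭ (λ x' → map (renC ρ) (inT (punchIn i x'))) (columnCells ∘ columnsAt) (allFin m))
      (++⁺ˡ otherInCells (↭-trans
        (↭-reflexive (sym (concatAll-restrictAll (λ (_ , D , _) → D) toO (All-resp-↭ Lo-↭ columns))))
        (concatAll-resp-↭ (λ (_ , D , _) → D) Lo-↭ columns))))
    outs-↭ : concatMap newOutCells (allFin n) ↭ otherOutCells ++ rowCells rows
    outs-↭ = ↭-trans (concatMap-cong-↭ (allFin n) newOutCells-↭)
      (↭-trans (concatMap-++-↭ (λ y' → map (renC ρ) (outT (punchIn o y'))) (rowCells ∘ rowsAt) (allFin n))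
      (++⁺ˡ otherOutCells (↭-trans
        (↭-reflexive (sym (concatAll-restrictAll proj₁ fromI (All-resp-↭ Li-↭ rows))))
        (concatAll-resp-↭ proj₁ Li-↭ rows))))

  N' : Net m n
  N' = net newCells ι₁ ω₁ l

  N₁-reduces : Reduct N₁ N' k'
  N₁-reduces =
    let rest = otherInCells ++ otherOutCells
        reduct s wf' fresh' = Reduces.run steps rest ι₁ ω₁ l
          (λ v k₀≤v → trans (sym (occ-↭ ι₁ ω₁ l cells-N₁-↭ v)) (fresh-above-max (netNames N₁) v k₀≤v))
          (WF-↭ ι₁ ω₁ l cells-N₁-↭ WF-N₁)
    in reduct (steps-↭ ι₁ ω₁ l cells-N₁-↭ ◅◅ s ◅◅ steps-↭ ι₁ ω₁ l newCells-↭) (WF-↭ ι₁ ω₁ l newCells-↭ wf')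
              (λ v k'≤v → trans (sym (occ-↭ ι₁ ω₁ l newCells-↭ v)) (fresh' v k'≤v))

  N'-routing : IsRouting (Tof R i o) N'
  N'-routing = record
    { wf = Reduct.wf N₁-reduces ; noLoops = noLoops
    ; inT = newInCells ; inL = newInLeaves ; inTree = λ x' → proj₁ (proj₂ (newIn x'))
    ; outT = newOutCells ; outL = newOutLeaves ; outTree = λ y' → proj₁ (proj₂ (newOut y'))
    ; W = W' ; W-len = length-W' ; inL-W = inL-W' ; outL-W = outL-W' ; cells-T = ↭-refl }

mainTheorem8 : ∀ {m n} (R : Fin (suc m) → Fin (suc n) → ℕ)
    (i : Fin (suc m)) (o : Fin (suc n)) → R i o ≡ 0 →
    (N : Net (suc m) (suc n)) → IsRouting R N →
    ∃ λ (N' : Net m n) → IsRouting (Tof R i o) N' × (connect N i o ⇒* N')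
mainTheorem8 R i o Rio≡0 (net cs ι ω l) IR =
  N' , N'-routing , subst (_⇒* N') (sym connect-≡) (Reduct.steps N₁-reduces)
  where open Connection R i o Rio≡0 cs ι ω l IR
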